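{- Let $\delta$ be a positive integer and consider the structure $\mathcal{M}=(\mathbb{N},0,S,P_\delta,<)$, where $S$ is the successor function and $P_\delta$ is interpreted as $\delta\mathbb{N}$. Let $L_\delta=\{0,S,P_\delta\}$ and $L_{\delta,<}=L_\delta\cup\{<\}$. Suppose $\phi(x_1,\ldots,x_n)$ is a quantifier-free $L_{\delta,<}$-formula which is stable with respect to every partition of its variables, i.e. for every partition of $\{x_1,\ldots,x_n\}$ into tuples $\bar x,\bar y$ there is $N$ such that there are no $\bar a_0,\ldots,\bar a_N,\bar b_0,\ldots,\bar b_N$ in $\mathcal{M}$ with $\mathcal{M}\models\phi(\bar a_i,\bar b_j)\iff i\le j$. Then $\phi$ is equivalent in $\mathcal{M}$ (equivalently, modulo the complete theory of $\mathcal{M}$) to a quantifier-free $L_\delta$-formula.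
   Context: $\mathbb{N}=\{0,1,2,\ldots\}$. -}

module Defs where

open import Data.Nat using (ℕ; zero; suc; _≤_; _<_)
open import Data.Nat.Divisibility using (_∣_)
open import Data.Fin using (Fin; toℕ)
open import Data.Bool using (Bool; true; false; if_then_else_)
open import Data.Product using (_×_; Σ; ∃)
open import Data.Sum using (_⊎_)
open import Data.Unit using (⊤)
open import Data.Empty using (⊥)
open import Relation.Nullary using (¬_)
open import Relation.Binary.PropositionalEquality using (_≡_)
open import Function.Bundles using (_⇔_)

data Term (n : ℕ) : Set where
  var : Fin n → Term n
  `0  : Term n
  `S  : Term n → Term n

data QF (n : ℕ) : Set where
  ⊤f ⊥f : QF n
  _≐_   : Term n → Term n → QF n
  P     : Term n → QF n
  _≺_   : Term n → Term n → QF n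
  ¬f_   : QF n → QF n
  _∧f_  : QF n → QF n → QF n
  _∨f_  : QF n → QF n → QF n

data LtFree {n : ℕ} : QF n → Set where
  ⊤f  : LtFree ⊤f
  ⊥f  : LtFree ⊥f
  eq  : ∀ t u → LtFree (t ≐ u)
  pd  : ∀ t → LtFree (P t)
  neg : ∀ {φ} → LtFree φ → LtFree (¬f φ)
  and : ∀ {φ ψ} → LtFree φ → LtFree ψ → LtFree (φ ∧f ψ)
  or  : ∀ {φ ψ} → LtFree φ → LtFree ψ → LtFree (φ ∨f ψ)

⟦_⟧t : ∀ {n} → Term n → (Fin n → ℕ) → ℕ
⟦ var i ⟧t a = a i
⟦ `0 ⟧t a = zero
⟦ `S t ⟧t a = suc (⟦ t ⟧t a)

⟦_⟧ : ∀ {n} → QF n → (δ : ℕ) → (Fin n → ℕ) → Set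
⟦ ⊤f ⟧ δ a = ⊤
⟦ ⊥f ⟧ δ a = ⊥
⟦ t ≐ u ⟧ δ a = ⟦ t ⟧t a ≡ ⟦ u ⟧t a
⟦ P t ⟧ δ a = δ ∣ ⟦ t ⟧t a
⟦ t ≺ u ⟧ δ a = ⟦ t ⟧t a < ⟦ u ⟧t a
⟦ ¬f φ ⟧ δ a = ¬ ⟦ φ ⟧ δ a
⟦ φ ∧f ψ ⟧ δ a = ⟦ φ ⟧ δ a × ⟦ ψ ⟧ δ a
⟦ φ ∨f ψ ⟧ δ a = ⟦ φ ⟧ δ a ⊎ ⟦ ψ ⟧ δ a

-- A partition of the variables into x̄ (side true) and ȳ (side false) is a
-- function s : Fin n → Bool.  Given values for the x̄-variables (a) and for the
-- ȳ-variables (b), combine them into one assignment (values of a at ȳ-positions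
-- and of b at x̄-positions are ignored).
combine : ∀ {n} → (Fin n → Bool) → (Fin n → ℕ) → (Fin n → ℕ) → Fin n → ℕ
combine s a b k = if s k then a k else b k

StableWrt : ∀ {n} → ℕ → QF n → (Fin n → Bool) → Set
StableWrt δ φ s =
  Σ ℕ λ N → ¬ (Σ (Fin (suc N) → Fin _ → ℕ) λ a → Σ (Fin (suc N) → Fin _ → ℕ) λ b →
      ∀ (i j : Fin (suc N)) → (⟦ φ ⟧ δ (combine s (a i) (b j)) ⇔ (toℕ i ≤ toℕ j)))

EquivInM : ∀ {n} → ℕ → QF n → QF n → Set
EquivInM δ φ ψ = ∀ (a : Fin _ → ℕ) → (⟦ φ ⟧ δ a ⇔ ⟦ ψ ⟧ δ a)

-- Let R bound the number of successors in the atoms of φ. For every assignment a, one of the scales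
-- L = 2ᵗ(R+1), t ≤ (n+1)², leaves no distance between the values of 0, x₁, …, xₙ in [L, 2L) (pigeonhole),
-- and this can be said without <. At such a scale the points within L of one another form clusters,
-- distinct clusters are more than 2R apart, and the truth of φ depends only on the positions inside
-- the clusters, the residues mod δ and the order of the clusters. Stability makes that order irrelevant:
-- if moving one cluster past others changed the truth of φ, interleaving the two positions would give
-- ladders of every length. So φ(a) holds iff φ holds at the arrangement ordering the clusters by their
-- least points, and there every atom t < u is equivalent to a quantifier-free formula without <.
module Submission where

open import Defs
open import Data.Nat using (ℕ; NonZero)
open import Data.Fin using (Fin)
open import Data.Bool using (Bool)
open import Data.Product using (Σ; _×_)

open import Data.Bool using (not; if_then_else_)
open import Data.Bool.Properties using (if-not)
open import Data.Empty using (⊥-elim)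
open import Data.Fin using (zero; suc; toℕ; fromℕ<; remQuot) renaming (combine to pairIndex)
open import Data.Fin.Properties
  using (toℕ<n; toℕ≤pred[n]; toℕ-fromℕ<; toℕ-injective; ⊎⇔∃; ∀-cons-⇔; all?; any?; ¬∀⟶∃¬; pigeonhole; remQuot-combine)
open import Data.Nat using (zero; suc; _+_; _*_; _≤_; _<_; _⊔_; z≤n; s≤s; z<s)
open import Data.Nat.Divisibility using (_∣_; _∣?_; ∣m∣n⇒∣m+n; ∣m+n∣m⇒∣n; n∣m*n)
open import Data.Nat.Properties
open import Data.Nat.Tactic.RingSolver using (solve-∀)
open import Algebra.Properties.CommutativeSemigroup +-commutativeSemigroup using (xy∙z≈xz∙y; xy∙z≈y∙xz)
open import Data.Product using (_,_; proj₁; proj₂; ∃; uncurry; swap)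
open import Data.Product.Function.NonDependent.Propositional using (_×-⇔_)
open import Data.Sum using (_⊎_; inj₁; inj₂)
open import Data.Sum.Function.Propositional using (_⊎-⇔_)
open import Data.Unit using (⊤; tt)
open import Function using (_∘_; id; case_of_)
open import Function.Bundles using (_⇔_; mk⇔; Equivalence)
open import Function.Properties.Equivalence using () renaming (refl to ⇔-refl; sym to ⇔-sym; trans to ⇔-trans)
open import Function.Related.TypeIsomorphisms using (¬-cong-⇔)
open import Relation.Binary.Definitions using (tri<; tri≈; tri>)
open import Relation.Binary.PropositionalEquality
open import Relation.Nullary using (¬_; Dec; yes; no; does; contradiction)
open import Relation.Nullary.Decidable using (¬?; _×-dec_; _⊎-dec_; _→-dec_; decidable-stable)

private
  variable
    m n : ℕ

∀-⇔ : {A : Set} {B C : A → Set} → (∀ x → B x ⇔ C x) → (∀ x → B x) ⇔ (∀ x → C x)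
∀-⇔ B⇔C = mk⇔ (λ h x → Equivalence.to (B⇔C x) (h x)) (λ h x → Equivalence.from (B⇔C x) (h x))

guarded-⇔ˡ : {A B C : Set} → A → ((A × B) ⊎ (¬ A × C)) ⇔ B
guarded-⇔ˡ a = mk⇔ (λ { (inj₁ (_ , b)) → b ; (inj₂ (¬a , _)) → contradiction a ¬a }) (λ b → inj₁ (a , b))

guarded-⇔ʳ : {A B C : Set} → ¬ A → ((A × B) ⊎ (¬ A × C)) ⇔ C
guarded-⇔ʳ ¬a = mk⇔ (λ { (inj₁ (a , _)) → contradiction a ¬a ; (inj₂ (_ , c)) → c }) (λ c → inj₂ (¬a , c))

if-does : {A B : Set} {x z r : B} (A? : Dec A) → (A → x ≡ r) → (¬ A → z ≡ r) → (if does A? then x else z) ≡ r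
if-does (yes a) x≡r _ = x≡r a
if-does (no ¬a) _ z≡r = z≡r ¬a

-- u + v′ ≡ u′ + v says u − u′ = v − v′ without truncated subtraction.
module _ {u u′ v v′ : ℕ} (u+v′≡u′+v : u + v′ ≡ u′ + v) (k m : ℕ) where
  private
    lhs : u + k + v′ ≡ u′ + (v + k)
    lhs = trans (xy∙z≈xz∙y u k v′) (trans (cong (_+ k) u+v′≡u′+v) (+-assoc u′ v k))
    rhs : u′ + m + v′ ≡ u′ + (v′ + m)
    rhs = trans (xy∙z≈xz∙y u′ m v′) (+-assoc u′ v′ m)

  +-transfer-≡ : u + k ≡ u′ + m → v + k ≡ v′ + m
  +-transfer-≡ h = +-cancelˡ-≡ u′ _ _ (trans (sym lhs) (trans (cong (_+ v′) h) rhs))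

  +-transfer-< : u + k < u′ + m → v + k < v′ + m
  +-transfer-< h = +-cancelˡ-< u′ _ _ (subst₂ _<_ lhs rhs (+-monoˡ-< v′ h))

+-transfer-sym : ∀ {u u′ v v′} → u + v′ ≡ u′ + v → v + u′ ≡ v′ + u
+-transfer-sym {u} {u′} {v} {v′} e = trans (+-comm v u′) (trans (sym e) (+-comm u v′))

+-transfer-≡-⇔ : ∀ {u u′ v v′} → u + v′ ≡ u′ + v → ∀ k m → (u + k ≡ u′ + m) ⇔ (v + k ≡ v′ + m)
+-transfer-≡-⇔ {u} {u′} {v} {v′} e k m =
  mk⇔ (+-transfer-≡ {u} {u′} {v} {v′} e k m) (+-transfer-≡ {v} {v′} {u} {u′} (+-transfer-sym {u} {u′} {v} {v′} e) k m)

+-transfer-<-⇔ : ∀ {u u′ v v′} → u + v′ ≡ u′ + v → ∀ k m → (u + k < u′ + m) ⇔ (v + k < v′ + m)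
+-transfer-<-⇔ {u} {u′} {v} {v′} e k m =
  mk⇔ (+-transfer-< {u} {u′} {v} {v′} e k m) (+-transfer-< {v} {v′} {u} {u′} (+-transfer-sym {u} {u′} {v} {v′} e) k m)

+-far-< : ∀ {x z F} k m → k < F → x + F ≤ z → x + k < z + m
+-far-< {x} {z} k m k<F x+F≤z = <-≤-trans (+-monoʳ-< x k<F) (≤-trans x+F≤z (m≤m+n z m))

∣-+k-mod : ∀ {δ x y} k i → y ≡ x + i * δ → (δ ∣ y + k) ⇔ (δ ∣ x + k)
∣-+k-mod {δ} {x} k i refl = mk⇔
  (λ h → ∣m+n∣m⇒∣n (subst (δ ∣_) (xy∙z≈y∙xz x (i * δ) k) h) (n∣m*n i))
  (λ h → subst (δ ∣_) (sym (xy∙z≈y∙xz x (i * δ) k)) (∣m∣n⇒∣m+n (n∣m*n i) h))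

distance<⇔offset : ∀ x z L → (z < x + L × x < z + L) ⇔ (∃ λ d → d < L × (x + d ≡ z ⊎ z + d ≡ x))
distance<⇔offset x z L = mk⇔ to from
  where
  offsetOf : ∀ {x z} → x ≤ z → z < x + L → ∃ λ d → d < L × x + d ≡ z
  offsetOf {x} x≤z z<x+L with d , x+d≡z ← m≤n⇒∃[o]m+o≡n x≤z =
    d , +-cancelˡ-< x d L (subst (_< x + L) (sym x+d≡z) z<x+L) , x+d≡z
  to : z < x + L × x < z + L → ∃ λ d → d < L × (x + d ≡ z ⊎ z + d ≡ x)
  to (z<x+L , x<z+L) with ≤-total x z
  ... | inj₁ x≤z = let d , d<L , e = offsetOf x≤z z<x+L in d , d<L , inj₁ e
  ... | inj₂ z≤x = let d , d<L , e = offsetOf z≤x x<z+L in d , d<L , inj₂ e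
  within : ∀ {x z d} → d < L → x + d ≡ z → z < x + L × x < z + L
  within {x} {z} {d} d<L refl = +-monoʳ-< x d<L , <-≤-trans (m<m+n x (≤-<-trans z≤n d<L)) (+-monoˡ-≤ L (m≤m+n x d))
  from : (∃ λ d → d < L × (x + d ≡ z ⊎ z + d ≡ x)) → z < x + L × x < z + L
  from (d , d<L , inj₁ e) = within d<L e
  from (d , d<L , inj₂ e) = swap (within d<L e)

noOffsetBelow⇔gap : ∀ x z L → (∀ d → d < L → ¬ (x + (L + d) ≡ z)) ⇔ (x + L ≤ z → x + (L + L) ≤ z)
noOffsetBelow⇔gap x z L = mk⇔ to from
  where
  to : (∀ d → d < L → ¬ (x + (L + d) ≡ z)) → x + L ≤ z → x + (L + L) ≤ z
  to h x+L≤z with x + (L + L) ≤? z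
  ... | yes x+2L≤z = x+2L≤z
  ... | no x+2L≰z with o , x+L+o≡z ← m≤n⇒∃[o]m+o≡n x+L≤z =
    contradiction (trans (sym (+-assoc x L o)) x+L+o≡z) (h o o<L)
    where
    o<L : o < L
    o<L = +-cancelˡ-< (x + L) o L (subst₂ _<_ (sym x+L+o≡z) (sym (+-assoc x L L)) (≰⇒> x+2L≰z))
  from : (x + L ≤ z → x + (L + L) ≤ z) → ∀ d → d < L → ¬ (x + (L + d) ≡ z)
  from h d d<L x+L+d≡z = <-irrefl refl (≤-<-trans (h x+L≤z) (subst (_< x + (L + L)) x+L+d≡z x+L+d<x+2L))
    where
    x+L≤z : x + L ≤ z
    x+L≤z = ≤-trans (+-monoʳ-≤ x (m≤m+n L d)) (≤-reflexive x+L+d≡z)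
    x+L+d<x+2L : x + (L + d) < x + (L + L)
    x+L+d<x+2L = +-monoʳ-< x (+-monoʳ-< L d<L)

keepBelow : ℕ → ℕ → ℕ
keepBelow k r = if does (r <? k) then r else 0

keepBelow-0 : ∀ k → keepBelow k 0 ≡ 0
keepBelow-0 k = if-does (0 <? k) (λ _ → refl) (λ _ → refl)

keepBelow-< : ∀ {k r} → r < k → keepBelow k r ≡ r
keepBelow-< {k} {r} r<k = if-does (r <? k) (λ _ → refl) (λ r≮k → contradiction r<k r≮k)

keepBelow-suc : ∀ {k r} → r ≢ k → keepBelow k r ≡ keepBelow (suc k) r
keepBelow-suc {k} {r} r≢k = if-does (r <? k)
  (λ r<k → sym (keepBelow-< (m<n⇒m<1+n r<k)))
  (λ r≮k → sym (if-does (r <? suc k)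
    (λ r<1+k → case m<1+n⇒m<n∨m≡n r<1+k of λ
      { (inj₁ r<k) → contradiction r<k r≮k
      ; (inj₂ r≡k) → contradiction r≡k r≢k })
    (λ _ → refl)))

<-step⇒strictMono : (f : ℕ → ℕ) → (∀ i → f i < f (suc i)) → ∀ {i j} → i < j → f i < f j
<-step⇒strictMono f step {i} {suc j} i<1+j with m<1+n⇒m<n∨m≡n i<1+j
... | inj₁ i<j = <-trans (<-step⇒strictMono f step i<j) (step j)
... | inj₂ refl = step i

module _ {f : ℕ → ℕ} (mono : ∀ {i j} → i < j → f i < f j) where

  strictMono⇒<-reflecting : ∀ {i j} → f i < f j → i < j
  strictMono⇒<-reflecting {i} {j} fi<fj with <-cmp i j
  ... | tri< i<j _ _ = i<j
  ... | tri≈ _ refl _ = contradiction fi<fj (<-irrefl refl)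
  ... | tri> _ _ j<i = contradiction (mono j<i) (<-asym fi<fj)

  strictMono⇒injective : ∀ {i j} → f i ≡ f j → i ≡ j
  strictMono⇒injective {i} {j} fi≡fj with <-cmp i j
  ... | tri< i<j _ _ = contradiction fi≡fj (<⇒≢ (mono i<j))
  ... | tri≈ _ i≡j _ = i≡j
  ... | tri> _ _ j<i = contradiction (sym fi≡fj) (<⇒≢ (mono j<i))

ladderLevel : ℕ → ℕ → ℕ → ℕ → ℕ
ladderLevel u v w 0 = 0
ladderLevel u v w 1 = u
ladderLevel u v w 2 = v
ladderLevel u v w (suc (suc (suc k))) = w + k

ladderLevel-mono : ∀ {u v w} → 0 < u → u < v → v < w → ∀ {i j} → i < j → ladderLevel u v w i < ladderLevel u v w j
ladderLevel-mono {u} {v} {w} 0<u u<v v<w = <-step⇒strictMono (ladderLevel u v w) step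
  where
  step : ∀ i → ladderLevel u v w i < ladderLevel u v w (suc i)
  step 0 = 0<u
  step 1 = u<v
  step 2 = subst (v <_) (sym (+-identityʳ w)) v<w
  step (suc (suc (suc k))) = +-monoʳ-< w (n<1+n k)

odd even top : ℕ → ℕ
odd i = suc (i + i)
even j = suc (suc (j + j))
top N = suc (suc (suc (N + N)))

odd<even : ∀ {i j} → i ≤ j → odd i < even j
odd<even i≤j = s≤s (s≤s (+-mono-≤ i≤j i≤j))

even<odd : ∀ {i j} → j < i → even j < odd i
even<odd {i} {j} j<i = s≤s (subst (_≤ i + i) (+-suc (suc j) j) (+-mono-≤ j<i j<i))

odd<top : ∀ {i N} → i ≤ N → odd i < top N
odd<top i≤N = s≤s (s≤s (m≤n⇒m≤1+n (+-mono-≤ i≤N i≤N)))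

even<top : ∀ {j N} → j ≤ N → even j < top N
even<top j≤N = s≤s (s≤s (s≤s (+-mono-≤ j≤N j≤N)))

sup : (Fin m → ℕ) → ℕ
sup {zero} f = 0
sup {suc m} f = f zero ⊔ sup (f ∘ suc)

≤-sup : (f : Fin m → ℕ) (i : Fin m) → f i ≤ sup f
≤-sup f zero = m≤m⊔n _ _
≤-sup f (suc i) = ≤-trans (≤-sup (f ∘ suc) i) (m≤n⊔m _ _)

-- The least index satisfying P, or m if there is none.
least : {P : Fin m → Set} → (∀ i → Dec (P i)) → ℕ
least {zero} P? = 0
least {suc m} P? with P? zero
... | yes _ = 0
... | no _ = suc (least (P? ∘ suc))

least-≤ : {P : Fin m → Set} (P? : ∀ i → Dec (P i)) → ∀ {i} → P i → least P? ≤ toℕ i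
least-≤ P? {zero} Pi with P? zero
... | yes _ = z≤n
... | no ¬P0 = contradiction Pi ¬P0
least-≤ P? {suc i} Pi with P? zero
... | yes _ = z≤n
... | no _ = s≤s (least-≤ (P? ∘ suc) Pi)

least-witness : {P : Fin m → Set} (P? : ∀ i → Dec (P i)) → ∀ {i} → P i → ∃ λ j → toℕ j ≡ least P? × P j
least-witness P? {zero} Pi with P? zero
... | yes P0 = zero , refl , P0
... | no ¬P0 = contradiction Pi ¬P0
least-witness P? {suc i} Pi with P? zero
... | yes P0 = zero , refl , P0
... | no _ with j , j≡least , Pj ← least-witness (P? ∘ suc) Pi = suc j , cong suc j≡least , Pj

least-cong : {P Q : Fin m → Set} (P? : ∀ i → Dec (P i)) (Q? : ∀ i → Dec (Q i)) →
  (∀ i → P i ⇔ Q i) → least P? ≡ least Q?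
least-cong {zero} P? Q? P⇔Q = refl
least-cong {suc m} P? Q? P⇔Q with P? zero | Q? zero
... | yes _ | yes _ = refl
... | yes P0 | no ¬Q0 = contradiction (Equivalence.to (P⇔Q zero) P0) ¬Q0
... | no ¬P0 | yes Q0 = contradiction (Equivalence.from (P⇔Q zero) Q0) ¬P0
... | no _ | no _ = cong suc (least-cong (P? ∘ suc) (Q? ∘ suc) (P⇔Q ∘ suc))

module _ {P Q : Fin m → Set} (P? : ∀ i → Dec (P i)) (Q? : ∀ i → Dec (Q i)) where

  least-≡⇒common : ∀ {i j} → P i → Q j → least P? ≡ least Q? → ∃ λ l → P l × Q l
  least-≡⇒common Pi Qj same with l , l≡ , Pl ← least-witness P? Pi | l′ , l′≡ , Ql′ ← least-witness Q? Qj =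
    l , Pl , subst Q (toℕ-injective (trans l′≡ (trans (sym same) (sym l≡)))) Ql′

  least<least⇔ : ∀ {i j} → P i → Q j → (least P? < least Q?) ⇔ (∃ λ l → P l × ∀ l′ → Q l′ → toℕ l < toℕ l′)
  least<least⇔ Pi Qj = mk⇔ to from
    where
    to : least P? < least Q? → ∃ λ l → P l × ∀ l′ → Q l′ → toℕ l < toℕ l′
    to lt with l , l≡ , Pl ← least-witness P? Pi = l , Pl , λ l′ Ql′ → <-≤-trans (subst (_< least Q?) (sym l≡) lt) (least-≤ Q? Ql′)
    from : (∃ λ l → P l × ∀ l′ → Q l′ → toℕ l < toℕ l′) → least P? < least Q?
    from (l , Pl , below) with l′ , l′≡ , Ql′ ← least-witness Q? Qj =
      ≤-<-trans (least-≤ P? Pl) (subst (toℕ l <_) l′≡ (below l′ Ql′))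

-- The points are the constant 0 (zero) and the variables (suc k); a term is a point plus an offset.
Point : ℕ → Set
Point n = Fin (suc n)

value : (Fin n → ℕ) → Point n → ℕ
value y zero = 0
value y (suc k) = y k

value≤sup : (y : Fin n → ℕ) (p : Point n) → value y p ≤ sup y
value≤sup y zero = z≤n
value≤sup y (suc k) = ≤-sup y k

pointTerm : Point n → Term n
pointTerm zero = `0
pointTerm (suc k) = var k

base : Term n → Point n
base (var k) = suc k
base `0 = zero
base (`S t) = base t

offset : Term n → ℕ
offset (var _) = 0
offset `0 = 0
offset (`S t) = suc (offset t)

S^ : ℕ → Term n → Term n
S^ zero t = t
S^ (suc k) t = `S (S^ k t)

⟦⟧t-normal : (t : Term n) (y : Fin n → ℕ) → ⟦ t ⟧t y ≡ value y (base t) + offset t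
⟦⟧t-normal (var k) y = sym (+-identityʳ (y k))
⟦⟧t-normal `0 y = refl
⟦⟧t-normal (`S t) y = trans (cong suc (⟦⟧t-normal t y)) (sym (+-suc _ _))

⟦pointTerm⟧ : (p : Point n) (y : Fin n → ℕ) → ⟦ pointTerm p ⟧t y ≡ value y p
⟦pointTerm⟧ zero y = refl
⟦pointTerm⟧ (suc k) y = refl

⟦S^⟧ : ∀ k (t : Term n) y → ⟦ S^ k t ⟧t y ≡ k + ⟦ t ⟧t y
⟦S^⟧ zero t y = refl
⟦S^⟧ (suc k) t y = cong suc (⟦S^⟧ k t y)

⟦_⟧? : (χ : QF n) (δ : ℕ) (y : Fin n → ℕ) → Dec (⟦ χ ⟧ δ y)
⟦ ⊤f ⟧? δ y = yes tt
⟦ ⊥f ⟧? δ y = no id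
⟦ t ≐ u ⟧? δ y = ⟦ t ⟧t y ≟ ⟦ u ⟧t y
⟦ P t ⟧? δ y = δ ∣? ⟦ t ⟧t y
⟦ t ≺ u ⟧? δ y = ⟦ t ⟧t y <? ⟦ u ⟧t y
⟦ ¬f χ ⟧? δ y = ¬? (⟦ χ ⟧? δ y)
⟦ χ ∧f ψ ⟧? δ y = ⟦ χ ⟧? δ y ×-dec ⟦ ψ ⟧? δ y
⟦ χ ∨f ψ ⟧? δ y = ⟦ χ ⟧? δ y ⊎-dec ⟦ ψ ⟧? δ y

⟦⟧t-cong : (t : Term n) {y z : Fin n → ℕ} → (∀ k → y k ≡ z k) → ⟦ t ⟧t y ≡ ⟦ t ⟧t z
⟦⟧t-cong (var k) y≗z = y≗z k
⟦⟧t-cong `0 y≗z = refl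
⟦⟧t-cong (`S t) y≗z = cong suc (⟦⟧t-cong t y≗z)

⟦⟧-cong : (χ : QF n) {δ : ℕ} {y z : Fin n → ℕ} → (∀ k → y k ≡ z k) → ⟦ χ ⟧ δ y ⇔ ⟦ χ ⟧ δ z
⟦⟧-cong ⊤f y≗z = ⇔-refl
⟦⟧-cong ⊥f y≗z = ⇔-refl
⟦⟧-cong (t ≐ u) y≗z rewrite ⟦⟧t-cong t y≗z | ⟦⟧t-cong u y≗z = ⇔-refl
⟦⟧-cong (P t) y≗z rewrite ⟦⟧t-cong t y≗z = ⇔-refl
⟦⟧-cong (t ≺ u) y≗z rewrite ⟦⟧t-cong t y≗z | ⟦⟧t-cong u y≗z = ⇔-refl
⟦⟧-cong (¬f χ) y≗z = ¬-cong-⇔ (⟦⟧-cong χ y≗z)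
⟦⟧-cong (χ ∧f ψ) y≗z = ⟦⟧-cong χ y≗z ×-⇔ ⟦⟧-cong ψ y≗z
⟦⟧-cong (χ ∨f ψ) y≗z = ⟦⟧-cong χ y≗z ⊎-⇔ ⟦⟧-cong ψ y≗z

⟦≐⟧-normal : ∀ {δ} (t u : Term n) y →
  ⟦ t ≐ u ⟧ δ y ⇔ (value y (base t) + offset t ≡ value y (base u) + offset u)
⟦≐⟧-normal t u y rewrite ⟦⟧t-normal t y | ⟦⟧t-normal u y = ⇔-refl

⟦≺⟧-normal : ∀ {δ} (t u : Term n) y →
  ⟦ t ≺ u ⟧ δ y ⇔ (value y (base t) + offset t < value y (base u) + offset u)
⟦≺⟧-normal t u y rewrite ⟦⟧t-normal t y | ⟦⟧t-normal u y = ⇔-refl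

⟦P⟧-normal : ∀ {δ} (t : Term n) y → ⟦ P t ⟧ δ y ⇔ (δ ∣ value y (base t) + offset t)
⟦P⟧-normal t y rewrite ⟦⟧t-normal t y = ⇔-refl

⋁ ⋀ : (Fin m → QF n) → QF n
⋁ {zero} f = ⊥f
⋁ {suc m} f = f zero ∨f ⋁ (f ∘ suc)
⋀ {zero} f = ⊤f
⋀ {suc m} f = f zero ∧f ⋀ (f ∘ suc)

⋁< ⋀< : ℕ → (ℕ → QF n) → QF n
⋁< L f = ⋁ (f ∘ toℕ {L})
⋀< L f = ⋀ (f ∘ toℕ {L})

_⇒f_ : QF n → QF n → QF n
χ ⇒f ψ = (¬f χ) ∨f ψ

⌜_⌝ : {A : Set} → Dec A → QF n
⌜ yes _ ⌝ = ⊤f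
⌜ no _ ⌝ = ⊥f

module _ {δ : ℕ} {y : Fin n → ℕ} where

  ⟦⋁⟧ : (f : Fin m → QF n) → ⟦ ⋁ f ⟧ δ y ⇔ ∃ λ i → ⟦ f i ⟧ δ y
  ⟦⋁⟧ {zero} f = mk⇔ (λ ()) (λ ())
  ⟦⋁⟧ {suc m} f = ⇔-trans (⇔-refl ⊎-⇔ ⟦⋁⟧ (f ∘ suc)) ⊎⇔∃

  ⟦⋀⟧ : (f : Fin m → QF n) → ⟦ ⋀ f ⟧ δ y ⇔ (∀ i → ⟦ f i ⟧ δ y)
  ⟦⋀⟧ {zero} f = mk⇔ (λ _ ()) (λ _ → tt)
  ⟦⋀⟧ {suc m} f = ⇔-trans (⇔-refl ×-⇔ ⟦⋀⟧ (f ∘ suc)) ∀-cons-⇔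

  ⟦⋁<⟧ : ∀ L (f : ℕ → QF n) → ⟦ ⋁< L f ⟧ δ y ⇔ ∃ λ d → d < L × ⟦ f d ⟧ δ y
  ⟦⋁<⟧ L f = ⇔-trans (⟦⋁⟧ (f ∘ toℕ)) (mk⇔
    (λ (i , h) → toℕ i , toℕ<n i , h)
    (λ (d , d<L , h) → fromℕ< d<L , subst (λ e → ⟦ f e ⟧ δ y) (sym (toℕ-fromℕ< d<L)) h))

  ⟦⋀<⟧ : ∀ L (f : ℕ → QF n) → ⟦ ⋀< L f ⟧ δ y ⇔ (∀ d → d < L → ⟦ f d ⟧ δ y)
  ⟦⋀<⟧ L f = ⇔-trans (⟦⋀⟧ (f ∘ toℕ)) (mk⇔
    (λ h d d<L → subst (λ e → ⟦ f e ⟧ δ y) (toℕ-fromℕ< d<L) (h (fromℕ< d<L)))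
    (λ h i → h (toℕ i) (toℕ<n i)))

  ⟦⌜⌝⟧ : {A : Set} (A? : Dec A) → ⟦ ⌜ A? ⌝ ⟧ δ y ⇔ A
  ⟦⌜⌝⟧ (yes a) = mk⇔ (λ _ → a) (λ _ → tt)
  ⟦⌜⌝⟧ (no ¬a) = mk⇔ (λ ()) ¬a

  ⟦⇒f⟧ : ∀ (χ ψ : QF n) → ⟦ χ ⇒f ψ ⟧ δ y ⇔ (⟦ χ ⟧ δ y → ⟦ ψ ⟧ δ y)
  ⟦⇒f⟧ χ ψ = mk⇔ (λ { (inj₁ ¬h) h → contradiction h ¬h ; (inj₂ h) _ → h })
    (λ h → case ⟦ χ ⟧? δ y of λ { (yes hχ) → inj₂ (h hχ) ; (no ¬hχ) → inj₁ ¬hχ })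

⋁-LtFree : (f : Fin m → QF n) → (∀ i → LtFree (f i)) → LtFree (⋁ f)
⋁-LtFree {zero} f h = ⊥f
⋁-LtFree {suc m} f h = or (h zero) (⋁-LtFree (f ∘ suc) (h ∘ suc))

⋀-LtFree : (f : Fin m → QF n) → (∀ i → LtFree (f i)) → LtFree (⋀ f)
⋀-LtFree {zero} f h = ⊤f
⋀-LtFree {suc m} f h = and (h zero) (⋀-LtFree (f ∘ suc) (h ∘ suc))

⌜⌝-LtFree : {A : Set} (A? : Dec A) → LtFree {n} ⌜ A? ⌝
⌜⌝-LtFree (yes _) = ⊤f
⌜⌝-LtFree (no _) = ⊥f

offsetEq : ℕ → Point n → Point n → QF n
offsetEq d p q = S^ d (pointTerm p) ≐ pointTerm q

⟦offsetEq⟧ : ∀ {δ} d (p q : Point n) y → ⟦ offsetEq d p q ⟧ δ y ⇔ (value y p + d ≡ value y q)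
⟦offsetEq⟧ d p q y rewrite ⟦S^⟧ d (pointTerm p) y | ⟦pointTerm⟧ p y | ⟦pointTerm⟧ q y | +-comm d (value y p) = ⇔-refl

OffsetsWithin : ℕ → QF n → Set
OffsetsWithin R (t ≐ u) = offset t ≤ R × offset u ≤ R
OffsetsWithin R (t ≺ u) = offset t ≤ R × offset u ≤ R
OffsetsWithin R (¬f χ) = OffsetsWithin R χ
OffsetsWithin R (χ ∧f ψ) = OffsetsWithin R χ × OffsetsWithin R ψ
OffsetsWithin R (χ ∨f ψ) = OffsetsWithin R χ × OffsetsWithin R ψ
OffsetsWithin R _ = ⊤

maxOffset : QF n → ℕ
maxOffset (t ≐ u) = offset t ⊔ offset u
maxOffset (t ≺ u) = offset t ⊔ offset u
maxOffset (¬f χ) = maxOffset χ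
maxOffset (χ ∧f ψ) = maxOffset χ ⊔ maxOffset ψ
maxOffset (χ ∨f ψ) = maxOffset χ ⊔ maxOffset ψ
maxOffset _ = 0

offsetsWithin-mono : ∀ (χ : QF n) {R R′} → R ≤ R′ → OffsetsWithin R χ → OffsetsWithin R′ χ
offsetsWithin-mono ⊤f R≤R′ h = h
offsetsWithin-mono ⊥f R≤R′ h = h
offsetsWithin-mono (t ≐ u) R≤R′ (ht , hu) = ≤-trans ht R≤R′ , ≤-trans hu R≤R′
offsetsWithin-mono (P t) R≤R′ h = h
offsetsWithin-mono (t ≺ u) R≤R′ (ht , hu) = ≤-trans ht R≤R′ , ≤-trans hu R≤R′
offsetsWithin-mono (¬f χ) R≤R′ h = offsetsWithin-mono χ R≤R′ h
offsetsWithin-mono (χ ∧f ψ) R≤R′ (hχ , hψ) = offsetsWithin-mono χ R≤R′ hχ , offsetsWithin-mono ψ R≤R′ hψ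
offsetsWithin-mono (χ ∨f ψ) R≤R′ (hχ , hψ) = offsetsWithin-mono χ R≤R′ hχ , offsetsWithin-mono ψ R≤R′ hψ

offsetsWithin-maxOffset : (χ : QF n) → OffsetsWithin (maxOffset χ) χ
offsetsWithin-maxOffset ⊤f = tt
offsetsWithin-maxOffset ⊥f = tt
offsetsWithin-maxOffset (t ≐ u) = m≤m⊔n _ _ , m≤n⊔m _ _
offsetsWithin-maxOffset (P t) = tt
offsetsWithin-maxOffset (t ≺ u) = m≤m⊔n _ _ , m≤n⊔m _ _
offsetsWithin-maxOffset (¬f χ) = offsetsWithin-maxOffset χ
offsetsWithin-maxOffset (χ ∧f ψ) =
  offsetsWithin-mono χ (m≤m⊔n _ _) (offsetsWithin-maxOffset χ) , offsetsWithin-mono ψ (m≤n⊔m _ _) (offsetsWithin-maxOffset ψ)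
offsetsWithin-maxOffset (χ ∨f ψ) =
  offsetsWithin-mono χ (m≤m⊔n _ _) (offsetsWithin-maxOffset χ) , offsetsWithin-mono ψ (m≤n⊔m _ _) (offsetsWithin-maxOffset ψ)

-- Formulas describing the clusters

record Near (a : Fin n → ℕ) (L : ℕ) (p q : Point n) : Set where
  constructor near
  field
    q<p+L : value a q < value a p + L
    p<q+L : value a p < value a q + L

closeFormula : ℕ → Point n → Point n → QF n
closeFormula L p q = ⋁< L λ d → offsetEq d p q ∨f offsetEq d q p

⟦closeFormula⟧ : ∀ {δ} (a : Fin n → ℕ) L p q → ⟦ closeFormula L p q ⟧ δ a ⇔ Near a L p q
⟦closeFormula⟧ {δ = δ} a L p q =
  ⇔-trans (⟦⋁<⟧ L (λ d → offsetEq d p q ∨f offsetEq d q p))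
    (⇔-trans (mk⇔ (λ (d , d<L , h) → d , d<L , Equivalence.to (offsets d) h)
                  (λ (d , d<L , h) → d , d<L , Equivalence.from (offsets d) h))
      (⇔-trans (⇔-sym (distance<⇔offset (value a p) (value a q) L)) (mk⇔ (uncurry near) λ (near x y) → x , y)))
  where
  offsets : ∀ d → ⟦ offsetEq d p q ∨f offsetEq d q p ⟧ δ a ⇔ (value a p + d ≡ value a q ⊎ value a q + d ≡ value a p)
  offsets d = ⟦offsetEq⟧ {δ = δ} d p q a ⊎-⇔ ⟦offsetEq⟧ {δ = δ} d q p a

closeFormula-LtFree : ∀ L (p q : Point n) → LtFree (closeFormula L p q)
closeFormula-LtFree L p q = ⋁-LtFree (λ i → offsetEq (toℕ i) p q ∨f offsetEq (toℕ i) q p) λ i →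
  or (eq (S^ (toℕ i) (pointTerm p)) (pointTerm q)) (eq (S^ (toℕ i) (pointTerm q)) (pointTerm p))

rankLtFormula : ℕ → Point n → Point n → QF n
rankLtFormula L p q = ⋁ λ l → closeFormula L l p ∧f ⋀ λ l′ → closeFormula L l′ q ⇒f ⌜ toℕ l <? toℕ l′ ⌝

⟦rankLtFormula⟧ : ∀ {δ} (a : Fin n → ℕ) L (p q : Point n) →
  ⟦ rankLtFormula L p q ⟧ δ a ⇔ (∃ λ l → Near a L l p × ∀ l′ → Near a L l′ q → toℕ l < toℕ l′)
⟦rankLtFormula⟧ {δ = δ} a L p q =
  ⇔-trans (⟦⋁⟧ (λ l → closeFormula L l p ∧f ⋀ (precedes l)))
    (mk⇔ (λ (l , h) → l , Equivalence.to (sem l) h) (λ (l , h) → l , Equivalence.from (sem l) h))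
  where
  precedes : Point _ → Point _ → QF _
  precedes l l′ = closeFormula L l′ q ⇒f ⌜ toℕ l <? toℕ l′ ⌝
  sem : ∀ l → ⟦ closeFormula L l p ∧f ⋀ (precedes l) ⟧ δ a ⇔ (Near a L l p × ∀ l′ → Near a L l′ q → toℕ l < toℕ l′)
  sem l = ⟦closeFormula⟧ a L l p ×-⇔ ⇔-trans (⟦⋀⟧ (precedes l)) (∀-⇔ λ l′ →
    ⇔-trans (⟦⇒f⟧ (closeFormula L l′ q) _) (mk⇔
      (λ h → Equivalence.to (⟦⌜⌝⟧ (toℕ l <? toℕ l′)) ∘ h ∘ Equivalence.from (⟦closeFormula⟧ a L l′ q))
      (λ h → Equivalence.from (⟦⌜⌝⟧ (toℕ l <? toℕ l′)) ∘ h ∘ Equivalence.to (⟦closeFormula⟧ a L l′ q))))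

rankLtFormula-LtFree : ∀ L (p q : Point n) → LtFree (rankLtFormula L p q)
rankLtFormula-LtFree L p q =
  ⋁-LtFree (λ l → closeFormula L l p ∧f ⋀ (precedes l)) λ l →
    and (closeFormula-LtFree L l p)
        (⋀-LtFree (precedes l) λ l′ → or (neg (closeFormula-LtFree L l′ q)) (⌜⌝-LtFree (toℕ l <? toℕ l′)))
  where
  precedes : Point _ → Point _ → QF _
  precedes l l′ = closeFormula L l′ q ⇒f ⌜ toℕ l <? toℕ l′ ⌝

shortLtFormula : ℕ → Term n → Term n → QF n
shortLtFormula B t u = ⋁< B λ e → S^ (suc e) t ≐ u

⟦shortLtFormula⟧ : ∀ {δ} B (t u : Term n) y → ⟦ u ⟧t y ≤ ⟦ t ⟧t y + B →
  ⟦ shortLtFormula B t u ⟧ δ y ⇔ (⟦ t ⟧t y < ⟦ u ⟧t y)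
⟦shortLtFormula⟧ B t u y u≤t+B = ⇔-trans (⟦⋁<⟧ B (λ e → S^ (suc e) t ≐ u)) (mk⇔ to from)
  where
  to : (∃ λ e → e < B × ⟦ S^ (suc e) t ⟧t y ≡ ⟦ u ⟧t y) → ⟦ t ⟧t y < ⟦ u ⟧t y
  to (e , _ , t+1+e≡u) = subst (⟦ t ⟧t y <_) (trans (sym (⟦S^⟧ (suc e) t y)) t+1+e≡u) (m<n+m _ z<s)
  from : ⟦ t ⟧t y < ⟦ u ⟧t y → ∃ λ e → e < B × ⟦ S^ (suc e) t ⟧t y ≡ ⟦ u ⟧t y
  from t<u with e , t+1+e≡u ← m≤n⇒∃[o]m+o≡n t<u = e , e<B , trans (⟦S^⟧ (suc e) t y) (trans (cong suc (+-comm e _)) t+1+e≡u)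
    where
    e<B : e < B
    e<B = +-cancelˡ-< (⟦ t ⟧t y) e B (≤-trans (≤-reflexive t+1+e≡u) u≤t+B)

-- Within a cluster t < u is a bounded offset; between clusters it compares the clusters' least points.
ltFormula : ℕ → ℕ → Term n → Term n → QF n
ltFormula R L t u =
  (closeFormula L (base t) (base u) ∧f shortLtFormula (L + R) t u)
  ∨f ((¬f closeFormula L (base t) (base u)) ∧f rankLtFormula L (base t) (base u))

translate : ℕ → ℕ → QF n → QF n
translate R L (t ≺ u) = ltFormula R L t u
translate R L (¬f χ) = ¬f translate R L χ
translate R L (χ ∧f ψ) = translate R L χ ∧f translate R L ψ
translate R L (χ ∨f ψ) = translate R L χ ∨f translate R L ψ
translate R L χ = χ

translate-LtFree : ∀ R L (χ : QF n) → LtFree (translate R L χ)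
translate-LtFree R L ⊤f = ⊤f
translate-LtFree R L ⊥f = ⊥f
translate-LtFree R L (t ≐ u) = eq t u
translate-LtFree R L (P t) = pd t
translate-LtFree R L (t ≺ u) =
  or (and (closeFormula-LtFree L _ _) (⋁-LtFree (λ i → S^ (suc (toℕ i)) t ≐ u) λ i → eq _ _))
     (and (neg (closeFormula-LtFree L _ _)) (rankLtFormula-LtFree L _ _))
translate-LtFree R L (¬f χ) = neg (translate-LtFree R L χ)
translate-LtFree R L (χ ∧f ψ) = and (translate-LtFree R L χ) (translate-LtFree R L ψ)
translate-LtFree R L (χ ∨f ψ) = or (translate-LtFree R L χ) (translate-LtFree R L ψ)

-- Scales with a gap

Gap : (Fin n → ℕ) → ℕ → Set
Gap a L = ∀ p q → value a p + L ≤ value a q → value a p + (L + L) ≤ value a q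

gap? : (a : Fin n → ℕ) (L : ℕ) → Dec (Gap a L)
gap? a L = all? λ p → all? λ q → (_ ≤? _) →-dec (_ ≤? _)

noShortOffset : ℕ → Point n → Point n → QF n
noShortOffset L p q = ⋀< L λ d → ¬f offsetEq (L + d) p q

gapFormula : ℕ → QF n
gapFormula L = ⋀ λ p → ⋀ λ q → noShortOffset L p q

⟦gapFormula⟧ : ∀ {δ} (a : Fin n → ℕ) L → ⟦ gapFormula L ⟧ δ a ⇔ Gap a L
⟦gapFormula⟧ {δ = δ} a L =
  ⇔-trans (⟦⋀⟧ (λ p → ⋀ (noShortOffset L p))) (∀-⇔ λ p → ⇔-trans (⟦⋀⟧ (noShortOffset L p)) (∀-⇔ λ q →
    ⇔-trans (⟦⋀<⟧ L (λ d → ¬f offsetEq (L + d) p q))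
      (⇔-trans (∀-⇔ λ d → ∀-⇔ λ _ → ¬-cong-⇔ (⟦offsetEq⟧ {δ = δ} (L + d) p q a)) (noOffsetBelow⇔gap _ _ L))))

gapFormula-LtFree : ∀ L → LtFree {n} (gapFormula L)
gapFormula-LtFree L =
  ⋀-LtFree (λ p → ⋀ (noShortOffset L p)) λ p → ⋀-LtFree (noShortOffset L p) λ q →
    ⋀-LtFree (λ i → ¬f offsetEq (L + toℕ i) p q) λ i → neg (eq _ _)

scale : ℕ → ℕ → ℕ
scale R zero = suc R
scale R (suc t) = scale R t + scale R t

R<scale : ∀ R t → R < scale R t
R<scale R zero = ≤-refl
R<scale R (suc t) = <-≤-trans (R<scale R t) (m≤m+n _ _)

scale-mono-≤ : ∀ R {s t} → s ≤ t → scale R s ≤ scale R t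
scale-mono-≤ R {zero} {zero} _ = ≤-refl
scale-mono-≤ R {zero} {suc t} _ = ≤-trans (scale-mono-≤ R {zero} {t} z≤n) (m≤m+n _ _)
scale-mono-≤ R {suc s} {suc t} (s≤s s≤t) = +-mono-≤ (scale-mono-≤ R s≤t) (scale-mono-≤ R s≤t)

scale-double-≤ : ∀ R {s t} → s < t → scale R s + scale R s ≤ scale R t
scale-double-≤ R {s} {suc t} (s≤s s≤t) = +-mono-≤ (scale-mono-≤ R s≤t) (scale-mono-≤ R s≤t)

InBand : (Fin n → ℕ) → ℕ → Point n × Point n → Set
InBand a L (p , q) = value a p + L ≤ value a q × value a q < value a p + (L + L)

¬gap⇒inBand : (a : Fin n → ℕ) (L : ℕ) → ¬ Gap a L → ∃ (InBand a L)
¬gap⇒inBand a L ¬gap with p , ¬∀q ← ¬∀⟶∃¬ _ _ (λ p → all? λ q → (_ ≤? _) →-dec (_ ≤? _)) ¬gap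
                    with q , ¬imp ← ¬∀⟶∃¬ _ _ (λ q → (_ ≤? _) →-dec (_ ≤? _)) ¬∀q
                    with value a p + L ≤? value a q
... | yes p+L≤q = (p , q) , p+L≤q , ≰⇒> (¬imp ∘ λ p+2L≤q _ → p+2L≤q)
... | no p+L≰q = contradiction (λ p+L≤q → contradiction p+L≤q p+L≰q) ¬imp

inBand-disjoint : ∀ (a : Fin n → ℕ) R {s t} → s < t → ∀ pq → ¬ (InBand a (scale R s) pq × InBand a (scale R t) pq)
inBand-disjoint a R s<t (p , q) ((_ , below) , (above , _)) =
  <-irrefl refl (<-≤-trans below (≤-trans (+-monoʳ-≤ (value a p) (scale-double-≤ R s<t)) above))

-- The intervals [2ˢ(R+1), 2ˢ⁺¹(R+1)) are pairwise disjoint, and there are only (n+1)² pairs of points.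
inBand-at-every-scale-impossible : (a : Fin n → ℕ) (R : ℕ) →
  ¬ (∀ (t : Fin (suc (suc n * suc n))) → ∃ (InBand a (scale R (toℕ t))))
inBand-at-every-scale-impossible {n} a R witness
  with i , j , i<j , same ← pigeonhole (n<1+n _) (uncurry pairIndex ∘ proj₁ ∘ witness) =
  inBand-disjoint a R i<j (proj₁ (witness i))
    (proj₂ (witness i) , subst (InBand a _) (sym (pairIndex-injective (proj₁ (witness i)) (proj₁ (witness j)) same)) (proj₂ (witness j)))
  where
  pairIndex-injective : ∀ (pq p′q′ : Point n × Point n) → uncurry pairIndex pq ≡ uncurry pairIndex p′q′ → pq ≡ p′q′
  pairIndex-injective (p , q) (p′ , q′) e =
    trans (sym (remQuot-combine p q)) (trans (cong (remQuot (suc n)) e) (remQuot-combine p′ q′))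

gap-exists : (a : Fin n → ℕ) (R : ℕ) → ∃ λ (t : Fin (suc (suc n * suc n))) → Gap a (scale R (toℕ t))
gap-exists a R with any? (λ t → gap? a (scale R (toℕ t)))
... | yes found = found
... | no none = ⊥-elim (inBand-at-every-scale-impossible a R λ t → ¬gap⇒inBand a _ (λ g → none (t , g)))

-- Clusters of an assignment with a gap

module Clustered {n : ℕ} (δ : ℕ) .{{_ : NonZero δ}} (R L : ℕ) (R<L : R < L) (a : Fin n → ℕ) (gap : Gap a L) where

  _≈_ : Point n → Point n → Set
  _≈_ = Near a L

  _≈?_ : ∀ p q → Dec (p ≈ q)
  p ≈? q with value a q <? value a p + L | value a p <? value a q + L
  ... | yes q<p+L | yes p<q+L = yes (near q<p+L p<q+L)
  ... | no ¬q<p+L | _ = no (¬q<p+L ∘ Near.q<p+L)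
  ... | _ | no ¬p<q+L = no (¬p<q+L ∘ Near.p<q+L)

  0<L : 0 < L
  0<L = ≤-<-trans z≤n R<L

  ≈-refl : ∀ {p} → p ≈ p
  ≈-refl = near (m<m+n _ 0<L) (m<m+n _ 0<L)

  ≈-sym : ∀ {p q} → p ≈ q → q ≈ p
  ≈-sym (near q<p+L p<q+L) = near p<q+L q<p+L

  -- p and r are less than 2L apart, and the gap excludes distances in [L, 2L).
  ≈-trans : ∀ {p q r} → p ≈ q → q ≈ r → p ≈ r
  ≈-trans {p} {q} {r} (near q<p+L p<q+L) (near r<q+L q<r+L) = near (within p q r q<p+L r<q+L) (within r q p q<r+L p<q+L)
    where
    within : ∀ x y z → value a y < value a x + L → value a z < value a y + L → value a z < value a x + L
    within x y z y<x+L z<y+L with value a z <? value a x + L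
    ... | yes z<x+L = z<x+L
    ... | no z≮x+L = contradiction (gap x z (≮⇒≥ z≮x+L))
                       (<⇒≱ (<-trans z<y+L (subst (value a y + L <_) (+-assoc _ L L) (+-monoˡ-< L y<x+L))))

  Apart : ℕ → ℕ → Set
  Apart x z = x + (L + L) ≤ z ⊎ z + (L + L) ≤ x

  ≉⇒apart : ∀ {p q} → ¬ p ≈ q → Apart (value a p) (value a q)
  ≉⇒apart {p} {q} p≉q with value a q <? value a p + L | value a p <? value a q + L
  ... | no q≮p+L | _ = inj₁ (gap p q (≮⇒≥ q≮p+L))
  ... | yes _ | no p≮q+L = inj₂ (gap q p (≮⇒≥ p≮q+L))
  ... | yes q<p+L | yes p<q+L = contradiction (near q<p+L p<q+L) p≉q

  0<L+L : 0 < L + L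
  0<L+L = <-≤-trans 0<L (m≤m+n L L)

  R<L+L : R < L + L
  R<L+L = <-≤-trans R<L (m≤m+n L L)

  apart-≤⇒ : ∀ {x z} → Apart x z → x ≤ z → x + (L + L) ≤ z
  apart-≤⇒ (inj₁ x+2L≤z) x≤z = x+2L≤z
  apart-≤⇒ {x} {z} (inj₂ z+2L≤x) x≤z = contradiction (≤-trans z+2L≤x x≤z) (<⇒≱ (m<m+n z 0<L+L))

  apart-≤⇒< : ∀ {x z} → Apart x z → x ≤ z → x < z
  apart-≤⇒< {x} h x≤z = <-≤-trans (m<m+n x 0<L+L) (apart-≤⇒ h x≤z)

  apart-offset-< : ∀ {x z} k m → k ≤ R → m ≤ R → Apart x z → (x + k < z + m) ⇔ (x < z)
  apart-offset-< {x} {z} k m k≤R m≤R h = mk⇔ to from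
    where
    to : x + k < z + m → x < z
    to x+k<z+m = case h of λ
      { (inj₁ x+2L≤z) → apart-≤⇒< h (≤-trans (m≤m+n x _) x+2L≤z)
      ; (inj₂ z+2L≤x) → contradiction x+k<z+m (<-asym (+-far-< m k (≤-<-trans m≤R R<L+L) z+2L≤x)) }
    from : x < z → x + k < z + m
    from x<z = +-far-< k m (≤-<-trans k≤R R<L+L) (apart-≤⇒ h (<⇒≤ x<z))

  apart-offset-≢ : ∀ {x z} k m → k ≤ R → m ≤ R → Apart x z → x + k ≢ z + m
  apart-offset-≢ k m k≤R m≤R (inj₁ x+2L≤z) = <⇒≢ (+-far-< k m (≤-<-trans k≤R R<L+L) x+2L≤z)
  apart-offset-≢ k m k≤R m≤R (inj₂ z+2L≤x) = ≢-sym (<⇒≢ (+-far-< m k (≤-<-trans m≤R R<L+L) z+2L≤x))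

  record Rearrangement (y : Fin n → ℕ) : Set where
    field
      near-offset : ∀ {p q} → p ≈ q → value y p + value a q ≡ value y q + value a p
      far-apart : ∀ {p q} → ¬ p ≈ q → Apart (value y p) (value y q)
      mod-δ : ∀ p → ∃ λ i → value y p ≡ value a p + i * δ

  a-rearrangement : Rearrangement a
  a-rearrangement = record
    { near-offset = λ {p} {q} _ → +-comm (value a p) (value a q)
    ; far-apart = ≉⇒apart
    ; mod-δ = λ p → 0 , sym (+-identityʳ _)
    }

  module _ {y : Fin n → ℕ} (ry : Rearrangement y) where
    open Rearrangement ry

    ≈⇒< : ∀ {p q} → p ≈ q → value y q < value y p + L
    ≈⇒< {p} {q} p≈q = subst₂ _<_ (+-identityʳ _) refl
      (+-transfer-< {value a q} {value a p} {value y q} {value y p}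
        (trans (+-comm (value a q) _) (trans (near-offset p≈q) (+-comm _ (value a p)))) 0 L
        (subst (_< value a p + L) (sym (+-identityʳ _)) (Near.q<p+L p≈q)))

    <-respects-≈ˡ : ∀ {p p′ q} → p ≈ p′ → ¬ p ≈ q → value y p < value y q → value y p′ < value y q
    <-respects-≈ˡ {p} {p′} {q} p≈p′ p≉q yp<yq with far-apart {p′} {q} (p≉q ∘ ≈-trans p≈p′)
    ... | inj₁ yp′+2L≤yq = <-≤-trans (m<m+n _ 0<L+L) yp′+2L≤yq
    ... | inj₂ yq+2L≤yp′ = contradiction (<-trans (≈⇒< p≈p′) (+-monoˡ-< L yp<yq))
                              (≤⇒≯ (≤-trans (+-monoʳ-≤ (value y q) (m≤m+n L L)) yq+2L≤yp′))

    <-respects-≈ʳ : ∀ {p p′ q} → p ≈ p′ → ¬ p ≈ q → value y q < value y p → value y q < value y p′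
    <-respects-≈ʳ {p} {p′} {q} p≈p′ p≉q yq<yp with value y q <? value y p′
    ... | yes yq<yp′ = yq<yp′
    ... | no yq≮yp′ = contradiction
      (<-respects-≈ˡ (≈-sym p≈p′) (p≉q ∘ ≈-trans p≈p′)
        (apart-≤⇒< (far-apart (p≉q ∘ ≈-trans p≈p′)) (≮⇒≥ yq≮yp′))) (<-asym yq<yp)

    offset-≡⇔a : ∀ p q k m → k ≤ R → m ≤ R → (value y p + k ≡ value y q + m) ⇔ (value a p + k ≡ value a q + m)
    offset-≡⇔a p q k m k≤R m≤R with p ≈? q
    ... | yes p≈q = +-transfer-≡-⇔ (near-offset p≈q) k m
    ... | no p≉q = mk⇔ (impossible (far-apart p≉q)) (impossible (≉⇒apart p≉q))
      where
      impossible : ∀ {x z w} → Apart x z → x + k ≡ z + m → w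
      impossible h e = contradiction e (apart-offset-≢ k m k≤R m≤R h)

    near-offset-<⇔a : ∀ p q k m → p ≈ q → (value y p + k < value y q + m) ⇔ (value a p + k < value a q + m)
    near-offset-<⇔a p q k m p≈q = +-transfer-<-⇔ (near-offset p≈q) k m

    offset-∣⇔a : ∀ p k → (δ ∣ value y p + k) ⇔ (δ ∣ value a p + k)
    offset-∣⇔a p k = ∣-+k-mod k (proj₁ (mod-δ p)) (proj₂ (mod-δ p))

    near-≺⇔a : ∀ t u → base t ≈ base u → ⟦ t ≺ u ⟧ δ y ⇔ ⟦ t ≺ u ⟧ δ a
    near-≺⇔a t u p≈q = ⇔-trans (⟦≺⟧-normal {δ = δ} t u y)
      (⇔-trans (near-offset-<⇔a (base t) (base u) _ _ p≈q) (⇔-sym (⟦≺⟧-normal {δ = δ} t u a)))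

  SameOrder : (y z : Fin n → ℕ) → Set
  SameOrder y z = ∀ {p q} → ¬ p ≈ q → (value y p < value y q) ⇔ (value z p < value z q)

  module _ {y z : Fin n → ℕ} (ry : Rearrangement y) (rz : Rearrangement z) where

    agree-≐ : ∀ t u → offset t ≤ R → offset u ≤ R → ⟦ t ≐ u ⟧ δ y ⇔ ⟦ t ≐ u ⟧ δ z
    agree-≐ t u t≤R u≤R =
      ⇔-trans (⟦≐⟧-normal {δ = δ} t u y) (⇔-trans (offset-≡⇔a ry (base t) (base u) _ _ t≤R u≤R)
        (⇔-trans (⇔-sym (offset-≡⇔a rz (base t) (base u) _ _ t≤R u≤R)) (⇔-sym (⟦≐⟧-normal {δ = δ} t u z))))

    agree-P : ∀ t → ⟦ P t ⟧ δ y ⇔ ⟦ P t ⟧ δ z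
    agree-P t = ⇔-trans (⟦P⟧-normal {δ = δ} t y)
      (⇔-trans (offset-∣⇔a ry (base t) _) (⇔-trans (⇔-sym (offset-∣⇔a rz (base t) _)) (⇔-sym (⟦P⟧-normal {δ = δ} t z))))

    agree-≺ : SameOrder y z → ∀ t u → offset t ≤ R → offset u ≤ R → ⟦ t ≺ u ⟧ δ y ⇔ ⟦ t ≺ u ⟧ δ z
    agree-≺ same t u t≤R u≤R = ⇔-trans (⟦≺⟧-normal {δ = δ} t u y) (⇔-trans offsets (⇔-sym (⟦≺⟧-normal {δ = δ} t u z)))
      where
      offsets : (value y (base t) + offset t < value y (base u) + offset u) ⇔ (value z (base t) + offset t < value z (base u) + offset u)
      offsets with base t ≈? base u
      ... | yes p≈q = ⇔-trans (near-offset-<⇔a ry (base t) (base u) _ _ p≈q) (⇔-sym (near-offset-<⇔a rz (base t) (base u) _ _ p≈q))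
      ... | no p≉q = ⇔-trans (apart-offset-< _ _ t≤R u≤R (Rearrangement.far-apart ry p≉q))
                       (⇔-trans (same p≉q) (⇔-sym (apart-offset-< _ _ t≤R u≤R (Rearrangement.far-apart rz p≉q))))

    rearrangements-agree : SameOrder y z → ∀ χ → OffsetsWithin R χ → ⟦ χ ⟧ δ y ⇔ ⟦ χ ⟧ δ z
    rearrangements-agree same ⊤f _ = ⇔-refl
    rearrangements-agree same ⊥f _ = ⇔-refl
    rearrangements-agree same (t ≐ u) (t≤R , u≤R) = agree-≐ t u t≤R u≤R
    rearrangements-agree same (P t) _ = agree-P t
    rearrangements-agree same (t ≺ u) (t≤R , u≤R) = agree-≺ same t u t≤R u≤R
    rearrangements-agree same (¬f χ) bχ = ¬-cong-⇔ (rearrangements-agree same χ bχ)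
    rearrangements-agree same (χ ∧f ψ) (bχ , bψ) = rearrangements-agree same χ bχ ×-⇔ rearrangements-agree same ψ bψ
    rearrangements-agree same (χ ∨f ψ) (bχ , bψ) = rearrangements-agree same χ bχ ⊎-⇔ rearrangements-agree same ψ bψ

  record Levelling (ρ : Point n → ℕ) : Set where
    field
      origin-level : ρ zero ≡ 0
      ≈⇒≡ : ∀ {p q} → p ≈ q → ρ p ≡ ρ q

  raise : (Fin n → ℕ) → ℕ → (Point n → ℕ) → Fin n → ℕ
  raise y M ρ k = y k + M * ρ (suc k)

  value-raise : ∀ y M {ρ} → ρ zero ≡ 0 → ∀ p → value (raise y M ρ) p ≡ value y p + M * ρ p
  value-raise y M ρ0≡0 zero = sym (trans (cong (M *_) ρ0≡0) (*-zeroʳ M))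
  value-raise y M ρ0≡0 (suc k) = refl

  LexBelow : (Point n → ℕ) → (Fin n → ℕ) → Point n → Point n → Set
  LexBelow ρ y p q = ρ p < ρ q ⊎ (ρ p ≡ ρ q × value y p < value y q)

  -- One level step exceeds every value of y by 2L, so clusters on different levels are ordered by level.
  headroom : (Fin n → ℕ) → ℕ
  headroom y = δ * (sup y + (L + L))

  value+2L≤headroom : ∀ y p → value y p + (L + L) ≤ headroom y
  value+2L≤headroom y p = ≤-trans (+-monoˡ-≤ (L + L) (value≤sup y p)) (m≤n*m _ δ)

  module Raise {y : Fin n → ℕ} (ry : Rearrangement y) {ρ : Point n → ℕ} (lev : Levelling ρ) where
    open Levelling lev

    M : ℕ
    M = headroom y

    raised : Fin n → ℕ
    raised = raise y M ρ

    value-raised : ∀ p → value raised p ≡ value y p + M * ρ p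
    value-raised = value-raise y M origin-level

    level<⇒apart : ∀ {p q} → ρ p < ρ q → value raised p + (L + L) ≤ value raised q
    level<⇒apart {p} {q} ρp<ρq = begin
      value raised p + (L + L)      ≡⟨ cong (_+ (L + L)) (value-raised p) ⟩
      value y p + M * ρ p + (L + L) ≡⟨ xy∙z≈xz∙y (value y p) _ _ ⟩
      value y p + (L + L) + M * ρ p ≤⟨ +-monoˡ-≤ (M * ρ p) (value+2L≤headroom y p) ⟩
      M + M * ρ p                   ≡⟨ *-suc M (ρ p) ⟨
      M * suc (ρ p)                 ≤⟨ *-monoʳ-≤ M ρp<ρq ⟩
      M * ρ q                       ≤⟨ m≤n+m _ (value y q) ⟩
      value y q + M * ρ q           ≡⟨ value-raised q ⟨
      value raised q                ∎
      where open ≤-Reasoning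

    raised-rearrangement : Rearrangement raised
    raised-rearrangement = record { near-offset = near-offset′ ; far-apart = far-apart′ ; mod-δ = mod-δ′ }
      where
      open Rearrangement ry
      near-offset′ : ∀ {p q} → p ≈ q → value raised p + value a q ≡ value raised q + value a p
      near-offset′ {p} {q} p≈q rewrite value-raised p | value-raised q | ≈⇒≡ p≈q =
        trans (xy∙z≈xz∙y (value y p) _ _) (trans (cong (_+ M * ρ q) (near-offset p≈q)) (xy∙z≈xz∙y (value y q) _ _))
      shifted : ∀ {x z} c → x + (L + L) ≤ z → x + c + (L + L) ≤ z + c
      shifted {x} {z} c h = subst (_≤ z + c) (xy∙z≈xz∙y x (L + L) c) (+-monoˡ-≤ c h)
      far-apart′ : ∀ {p q} → ¬ p ≈ q → Apart (value raised p) (value raised q)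
      far-apart′ {p} {q} p≉q with <-cmp (ρ p) (ρ q)
      ... | tri< ρp<ρq _ _ = inj₁ (level<⇒apart ρp<ρq)
      ... | tri> _ _ ρq<ρp = inj₂ (level<⇒apart ρq<ρp)
      ... | tri≈ _ ρp≡ρq _ rewrite value-raised p | value-raised q | ρp≡ρq with far-apart p≉q
      ...   | inj₁ h = inj₁ (shifted {value y p} {value y q} (M * ρ q) h)
      ...   | inj₂ h = inj₂ (shifted {value y q} {value y p} (M * ρ q) h)
      mod-δ′ : ∀ p → ∃ λ i → value raised p ≡ value a p + i * δ
      mod-δ′ p with i , yp≡ ← mod-δ p = i + (sup y + (L + L)) * ρ p , (begin
        value raised p ≡⟨ value-raised p ⟩
        value y p + M * ρ p ≡⟨ cong (_+ M * ρ p) yp≡ ⟩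
        value a p + i * δ + δ * (sup y + (L + L)) * ρ p ≡⟨ regroup (value a p) i δ (sup y + (L + L)) (ρ p) ⟩
        value a p + (i + (sup y + (L + L)) * ρ p) * δ ∎)
        where
        open ≡-Reasoning
        regroup : ∀ x i δ H r → x + i * δ + δ * H * r ≡ x + (i + H * r) * δ
        regroup = solve-∀

    raised-lex : ∀ {p q} → ¬ p ≈ q → (value raised p < value raised q) ⇔ LexBelow ρ y p q
    raised-lex {p} {q} p≉q = mk⇔ to from
      where
      to : value raised p < value raised q → LexBelow ρ y p q
      to h with <-cmp (ρ p) (ρ q)
      ... | tri< ρp<ρq _ _ = inj₁ ρp<ρq
      ... | tri> _ _ ρq<ρp = contradiction h (<-asym (<-≤-trans (m<m+n _ 0<L+L) (level<⇒apart ρq<ρp)))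
      ... | tri≈ _ ρp≡ρq _ = inj₂ (ρp≡ρq , +-cancelʳ-< (M * ρ q) _ _
              (subst₂ _<_ (trans (value-raised p) (cong (λ r → value y p + M * r) ρp≡ρq)) (value-raised q) h))
      from : LexBelow ρ y p q → value raised p < value raised q
      from (inj₁ ρp<ρq) = <-≤-trans (m<m+n _ 0<L+L) (level<⇒apart ρp<ρq)
      from (inj₂ (ρp≡ρq , yp<yq)) = subst₂ _<_
        (sym (trans (value-raised p) (cong (λ r → value y p + M * r) ρp≡ρq))) (sym (value-raised q)) (+-monoˡ-< (M * ρ q) yp<yq)

  lex⇔< : ∀ {ρ : Point n → ℕ} {y z : Fin n → ℕ} {p q} →
    (ρ p < ρ q → value z p < value z q) → (ρ q < ρ p → value z q < value z p) →
    (ρ p ≡ ρ q → (value y p < value y q) ⇔ (value z p < value z q)) →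
    LexBelow ρ y p q ⇔ (value z p < value z q)
  lex⇔< {ρ} {p = p} {q} up down level = mk⇔ to from
    where
    to : LexBelow ρ _ p q → _
    to (inj₁ ρp<ρq) = up ρp<ρq
    to (inj₂ (ρp≡ρq , yp<yq)) = Equivalence.to (level ρp≡ρq) yp<yq
    from : _ → LexBelow ρ _ p q
    from zp<zq with <-cmp (ρ p) (ρ q)
    ... | tri< ρp<ρq _ _ = inj₁ ρp<ρq
    ... | tri≈ _ ρp≡ρq _ = inj₂ (ρp≡ρq , Equivalence.from (level ρp≡ρq) zp<zq)
    ... | tri> _ _ ρq<ρp = contradiction (down ρq<ρp) (<-asym zp<zq)

  module MoveCluster (φ : QF n) (φ-offsets : OffsetsWithin R φ) (stable : (s : Fin n → Bool) → StableWrt δ φ s)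
                     {y y′ : Fin n → ℕ} (ry : Rearrangement y) (ry′ : Rearrangement y′)
                     (c : Point n) (0≉c : ¬ zero ≈ c) (D : ℕ)
                     (moved : ∀ k → suc k ≈ c → y′ k ≡ y k + D) (fixed : ∀ k → ¬ suc k ≈ c → y′ k ≡ y k) where
    open Rearrangement

    y′-moved : ∀ {p} → p ≈ c → value y′ p ≡ value y p + D
    y′-moved {zero} 0≈c = contradiction 0≈c 0≉c
    y′-moved {suc k} = moved k

    y′-fixed : ∀ {p} → ¬ p ≈ c → value y′ p ≡ value y p
    y′-fixed {zero} _ = refl
    y′-fixed {suc k} = fixed k

    -- The position of a point relative to the cluster of c, which moves up from y to y′.
    data Region (p : Point n) : Set where
      inside : p ≈ c → Region p
      below : ¬ p ≈ c → value y p < value y c → Region p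
      overtaken : ¬ p ≈ c → value y c < value y p → value y′ p < value y′ c → Region p
      above : ¬ p ≈ c → value y c < value y p → value y′ c < value y′ p → Region p

    region : ∀ p → Region p
    region p with p ≈? c
    ... | yes p≈c = inside p≈c
    ... | no p≉c with value y p <? value y c
    ...   | yes yp<yc = below p≉c yp<yc
    ...   | no yp≮yc = aboveOrOvertaken (apart-≤⇒< (far-apart ry (p≉c ∘ ≈-sym)) (≮⇒≥ yp≮yc))
      where
      aboveOrOvertaken : value y c < value y p → Region p
      aboveOrOvertaken yc<yp with value y′ c <? value y′ p
      ... | yes y′c<y′p = above p≉c yc<yp y′c<y′p
      ... | no y′c≮y′p = overtaken p≉c yc<yp (apart-≤⇒< (far-apart ry′ p≉c) (≮⇒≥ y′c≮y′p))

    yHeight y′Height : ∀ {p} → Region p → ℕ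
    yHeight (below _ _) = 0
    yHeight (inside _) = 1
    yHeight (overtaken _ _ _) = 2
    yHeight (above _ _ _) = 3
    y′Height (below _ _) = 0
    y′Height (overtaken _ _ _) = 1
    y′Height (inside _) = 2
    y′Height (above _ _ _) = 3

    y′-below : ∀ {p} → ¬ p ≈ c → value y p < value y c → value y′ p < value y′ c
    y′-below p≉c yp<yc = subst₂ _<_ (sym (y′-fixed p≉c)) (sym (y′-moved ≈-refl)) (<-≤-trans yp<yc (m≤m+n _ D))

    y-monotone : ∀ {p q} (rp : Region p) (rq : Region q) → yHeight rp < yHeight rq → value y p < value y q
    y-monotone (below p≉c yp<yc) (inside q≈c) _ = <-respects-≈ʳ ry (≈-sym q≈c) (p≉c ∘ ≈-sym) yp<yc
    y-monotone (below _ yp<yc) (overtaken _ yc<yq _) _ = <-trans yp<yc yc<yq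
    y-monotone (below _ yp<yc) (above _ yc<yq _) _ = <-trans yp<yc yc<yq
    y-monotone (inside p≈c) (overtaken q≉c yc<yq _) _ = <-respects-≈ˡ ry (≈-sym p≈c) (q≉c ∘ ≈-sym) yc<yq
    y-monotone (inside p≈c) (above q≉c yc<yq _) _ = <-respects-≈ˡ ry (≈-sym p≈c) (q≉c ∘ ≈-sym) yc<yq
    y-monotone (overtaken p≉c _ y′p<y′c) (above q≉c _ y′c<y′q) _ =
      subst₂ _<_ (y′-fixed p≉c) (y′-fixed q≉c) (<-trans y′p<y′c y′c<y′q)
    y-monotone (below _ _) (below _ _) ()
    y-monotone (inside _) (below _ _) ()
    y-monotone (overtaken _ _ _) (below _ _) ()
    y-monotone (above _ _ _) (below _ _) ()
    y-monotone (inside _) (inside _) (s≤s ())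
    y-monotone (overtaken _ _ _) (inside _) (s≤s ())
    y-monotone (above _ _ _) (inside _) (s≤s ())
    y-monotone (overtaken _ _ _) (overtaken _ _ _) (s≤s (s≤s ()))
    y-monotone (above _ _ _) (overtaken _ _ _) (s≤s (s≤s ()))
    y-monotone (above _ _ _) (above _ _ _) (s≤s (s≤s (s≤s ())))

    y′-monotone : ∀ {p q} (rp : Region p) (rq : Region q) → y′Height rp < y′Height rq → value y′ p < value y′ q
    y′-monotone (below p≉c yp<yc) (overtaken q≉c yc<yq _) _ =
      subst₂ _<_ (sym (y′-fixed p≉c)) (sym (y′-fixed q≉c)) (<-trans yp<yc yc<yq)
    y′-monotone (below p≉c yp<yc) (inside q≈c) _ = <-respects-≈ʳ ry′ (≈-sym q≈c) (p≉c ∘ ≈-sym) (y′-below p≉c yp<yc)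
    y′-monotone (below p≉c yp<yc) (above _ _ y′c<y′q) _ = <-trans (y′-below p≉c yp<yc) y′c<y′q
    y′-monotone (overtaken p≉c _ y′p<y′c) (inside q≈c) _ = <-respects-≈ʳ ry′ (≈-sym q≈c) (p≉c ∘ ≈-sym) y′p<y′c
    y′-monotone (overtaken _ _ y′p<y′c) (above _ _ y′c<y′q) _ = <-trans y′p<y′c y′c<y′q
    y′-monotone (inside p≈c) (above q≉c _ y′c<y′q) _ = <-respects-≈ˡ ry′ (≈-sym p≈c) (q≉c ∘ ≈-sym) y′c<y′q
    y′-monotone (below _ _) (below _ _) ()
    y′-monotone (overtaken _ _ _) (below _ _) ()
    y′-monotone (inside _) (below _ _) ()
    y′-monotone (above _ _ _) (below _ _) ()
    y′-monotone (overtaken _ _ _) (overtaken _ _ _) (s≤s ())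
    y′-monotone (inside _) (overtaken _ _ _) (s≤s ())
    y′-monotone (above _ _ _) (overtaken _ _ _) (s≤s ())
    y′-monotone (inside _) (inside _) (s≤s (s≤s ()))
    y′-monotone (above _ _ _) (inside _) (s≤s (s≤s ()))
    y′-monotone (above _ _ _) (above _ _ _) (s≤s (s≤s (s≤s ())))

    y′Height≡2⇔≈c : ∀ p → (y′Height (region p) ≡ 2) ⇔ (p ≈ c)
    y′Height≡2⇔≈c p with region p
    ... | inside p≈c = mk⇔ (λ _ → p≈c) (λ _ → refl)
    ... | below p≉c _ = mk⇔ (λ ()) (λ p≈c → contradiction p≈c p≉c)
    ... | overtaken p≉c _ _ = mk⇔ (λ ()) (λ p≈c → contradiction p≈c p≉c)
    ... | above p≉c _ _ = mk⇔ (λ ()) (λ p≈c → contradiction p≈c p≉c)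

    shared-height⇒outside : ∀ {p q} → ¬ p ≈ q → y′Height (region p) ≡ y′Height (region q) → ¬ p ≈ c
    shared-height⇒outside {p} {q} p≉q e p≈c = p≉q (≈-trans p≈c (≈-sym (Equivalence.to (y′Height≡2⇔≈c q)
      (trans (sym e) (Equivalence.from (y′Height≡2⇔≈c p) p≈c)))))

    region-zero : yHeight (region zero) ≡ 0
    region-zero with region zero
    ... | inside 0≈c = contradiction 0≈c 0≉c
    ... | below _ _ = refl
    ... | overtaken _ yc<y0 _ = contradiction yc<y0 n≮0
    ... | above _ yc<y0 _ = contradiction yc<y0 n≮0

    region-≈ : ∀ {p q} → p ≈ q → yHeight (region p) ≡ yHeight (region q)
    region-≈ {p} {q} p≈q with region p | region q
    ... | inside _ | inside _ = refl
    ... | below _ _ | below _ _ = refl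
    ... | overtaken _ _ _ | overtaken _ _ _ = refl
    ... | above _ _ _ | above _ _ _ = refl
    ... | inside p≈c | below q≉c _ = contradiction (≈-trans (≈-sym p≈q) p≈c) q≉c
    ... | inside p≈c | overtaken q≉c _ _ = contradiction (≈-trans (≈-sym p≈q) p≈c) q≉c
    ... | inside p≈c | above q≉c _ _ = contradiction (≈-trans (≈-sym p≈q) p≈c) q≉c
    ... | below p≉c _ | inside q≈c = contradiction (≈-trans p≈q q≈c) p≉c
    ... | overtaken p≉c _ _ | inside q≈c = contradiction (≈-trans p≈q q≈c) p≉c
    ... | above p≉c _ _ | inside q≈c = contradiction (≈-trans p≈q q≈c) p≉c
    ... | below p≉c yp<yc | overtaken _ yc<yq _ = contradiction (<-respects-≈ˡ ry p≈q p≉c yp<yc) (<-asym yc<yq)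
    ... | below p≉c yp<yc | above _ yc<yq _ = contradiction (<-respects-≈ˡ ry p≈q p≉c yp<yc) (<-asym yc<yq)
    ... | overtaken _ yc<yp _ | below q≉c yq<yc = contradiction (<-respects-≈ˡ ry (≈-sym p≈q) q≉c yq<yc) (<-asym yc<yp)
    ... | above _ yc<yp _ | below q≉c yq<yc = contradiction (<-respects-≈ˡ ry (≈-sym p≈q) q≉c yq<yc) (<-asym yc<yp)
    ... | overtaken p≉c _ y′p<y′c | above _ _ y′c<y′q =
      contradiction (<-respects-≈ˡ ry′ p≈q p≉c y′p<y′c) (<-asym y′c<y′q)
    ... | above _ _ y′c<y′p | overtaken q≉c _ y′q<y′c =
      contradiction (<-respects-≈ˡ ry′ (≈-sym p≈q) q≉c y′q<y′c) (<-asym y′c<y′p)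

    levels : ℕ → ℕ → ℕ → Point n → ℕ
    levels u v w p = ladderLevel u v w (yHeight (region p))

    levels-y′ : ∀ u v w p → levels u v w p ≡ ladderLevel v u w (y′Height (region p))
    levels-y′ u v w p with region p
    ... | inside _ = refl
    ... | below _ _ = refl
    ... | overtaken _ _ _ = refl
    ... | above _ _ _ = refl

    levels-inside : ∀ {u v w p} → p ≈ c → levels u v w p ≡ u
    levels-inside {p = p} p≈c with region p
    ... | inside _ = refl
    ... | below p≉c _ = contradiction p≈c p≉c
    ... | overtaken p≉c _ _ = contradiction p≈c p≉c
    ... | above p≉c _ _ = contradiction p≈c p≉c

    levels-outside : ∀ {u u′ v w p} → ¬ p ≈ c → levels u v w p ≡ levels u′ v w p
    levels-outside {p = p} p≉c with region p
    ... | inside p≈c = contradiction p≈c p≉c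
    ... | below _ _ = refl
    ... | overtaken _ _ _ = refl
    ... | above _ _ _ = refl

    levels-levelling : ∀ u v w → Levelling (levels u v w)
    levels-levelling u v w = record
      { origin-level = cong (ladderLevel u v w) region-zero
      ; ≈⇒≡ = cong (ladderLevel u v w) ∘ region-≈
      }

    configuration : ℕ → ℕ → ℕ → Fin n → ℕ
    configuration u v w = raise y (headroom y) (levels u v w)

    configuration≈y : ∀ {u v w} → 0 < u → u < v → v < w → ⟦ φ ⟧ δ (configuration u v w) ⇔ ⟦ φ ⟧ δ y
    configuration≈y {u} {v} {w} 0<u u<v v<w =
      rearrangements-agree raised-rearrangement ry
        (λ {p} {q} p≉q → ⇔-trans (raised-lex p≉q) (lex⇔< {levels u v w} {y} {y} {p} {q} (up {p} {q}) (up {q} {p}) (λ _ → ⇔-refl)))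
        φ φ-offsets
      where
      open Raise ry (levels-levelling u v w)
      up : ∀ {p q} → levels u v w p < levels u v w q → value y p < value y q
      up {p} {q} lt = y-monotone (region p) (region q) (strictMono⇒<-reflecting (ladderLevel-mono 0<u u<v v<w) lt)

    configuration≈y′ : ∀ {u v w} → 0 < v → v < u → u < w → ⟦ φ ⟧ δ (configuration u v w) ⇔ ⟦ φ ⟧ δ y′
    configuration≈y′ {u} {v} {w} 0<v v<u u<w =
      rearrangements-agree raised-rearrangement ry′
        (λ {p} {q} p≉q → ⇔-trans (raised-lex p≉q) (lex⇔< {levels u v w} {y} {y′} {p} {q} (up {p} {q}) (up {q} {p}) (shared p≉q)))
        φ φ-offsets
      where
      open Raise ry (levels-levelling u v w)
      mono : ∀ {i j} → i < j → ladderLevel v u w i < ladderLevel v u w j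
      mono = ladderLevel-mono 0<v v<u u<w
      up : ∀ {p q} → levels u v w p < levels u v w q → value y′ p < value y′ q
      up {p} {q} lt =
        y′-monotone (region p) (region q) (strictMono⇒<-reflecting mono (subst₂ _<_ (levels-y′ u v w p) (levels-y′ u v w q) lt))
      shared : ∀ {p q} → ¬ p ≈ q → levels u v w p ≡ levels u v w q → (value y p < value y q) ⇔ (value y′ p < value y′ q)
      shared {p} {q} p≉q same =
        let heights = strictMono⇒injective mono (trans (sym (levels-y′ u v w p)) (trans same (levels-y′ u v w q))) in
        subst₂ (λ yp yq → (value y p < value y q) ⇔ (yp < yq))
          (sym (y′-fixed (shared-height⇒outside p≉q heights))) (sym (y′-fixed (shared-height⇒outside (p≉q ∘ ≈-sym) (sym heights))))
          ⇔-refl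

    c-side : Fin n → Bool
    c-side k = does (suc k ≈? c)

    atLevel : ℕ → Fin n → ℕ
    atLevel u k = y k + headroom y * u

    others : ℕ → ℕ → Fin n → ℕ
    others v w = configuration 0 v w

    combine-configuration : ∀ u v w k → combine c-side (atLevel u) (others v w) k ≡ configuration u v w k
    combine-configuration u v w k = if-does (suc k ≈? c)
      (λ k≈c → cong (λ l → y k + headroom y * l) (sym (levels-inside k≈c)))
      (λ k≉c → cong (λ l → y k + headroom y * l) (levels-outside k≉c))

    -- Were φ true at y and false at y′, placing c's cluster at level 2i+1 and the clusters it
    -- overtakes at level 2j+2 would make φ hold exactly when i ≤ j: a ladder of every length.
    true-persists : ⟦ φ ⟧ δ y → ⟦ φ ⟧ δ y′
    true-persists φy = decidable-stable (⟦ φ ⟧? δ y′) λ ¬φy′ →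
      let N , no-ladder = stable c-side in
      no-ladder ((λ i → atLevel (odd (toℕ i))) , (λ j → others (even (toℕ j)) (top N)) , λ i j →
        ⇔-trans (⟦⟧-cong φ (combine-configuration _ _ _)) (mk⇔
          (λ φc → case toℕ i ≤? toℕ j of λ
            { (yes i≤j) → i≤j
            ; (no i≰j) → contradiction
                (Equivalence.to (configuration≈y′ z<s (even<odd (≰⇒> i≰j)) (odd<top (toℕ≤pred[n] i))) φc) ¬φy′ })
          (λ i≤j → Equivalence.from (configuration≈y z<s (odd<even i≤j) (even<top (toℕ≤pred[n] j))) φy)))

    true-reflects : ⟦ φ ⟧ δ y′ → ⟦ φ ⟧ δ y
    true-reflects φy′ = decidable-stable (⟦ φ ⟧? δ y) λ ¬φy →
      let N , no-ladder = stable (not ∘ c-side) in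
      no-ladder ((λ i → others (odd (toℕ i)) (top N)) , (λ j → atLevel (even (toℕ j))) , λ i j →
        ⇔-trans (⟦⟧-cong φ (λ k → trans (if-not (c-side k)) (combine-configuration _ _ _ k))) (mk⇔
          (λ φc → case toℕ i ≤? toℕ j of λ
            { (yes i≤j) → i≤j
            ; (no i≰j) → contradiction
                (Equivalence.to (configuration≈y z<s (even<odd (≰⇒> i≰j)) (odd<top (toℕ≤pred[n] i))) φc) ¬φy })
          (λ i≤j → Equivalence.from (configuration≈y′ z<s (odd<even i≤j) (even<top (toℕ≤pred[n] j))) φy′)))

    move-cluster : ⟦ φ ⟧ δ y ⇔ ⟦ φ ⟧ δ y′
    move-cluster = mk⇔ true-persists true-reflects

  rank : Point n → ℕ
  rank p = least (_≈? p)

  rank-≈ : ∀ {p q} → p ≈ q → rank p ≡ rank q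
  rank-≈ {p} {q} p≈q =
    least-cong (_≈? p) (_≈? q) λ l → mk⇔ (λ l≈p → ≈-trans l≈p p≈q) (λ l≈q → ≈-trans l≈q (≈-sym p≈q))

  rank-zero : rank zero ≡ 0
  rank-zero = n≤0⇒n≡0 (least-≤ (_≈? zero) ≈-refl)

  rank-≡⇒≈ : ∀ {p q} → rank p ≡ rank q → p ≈ q
  rank-≡⇒≈ {p} {q} e with l , l≈p , l≈q ← least-≡⇒common (_≈? p) (_≈? q) ≈-refl ≈-refl e = ≈-trans (≈-sym l≈p) l≈q

  rank<1+n : ∀ p → rank p < suc n
  rank<1+n p = ≤-<-trans (least-≤ (_≈? p) ≈-refl) (toℕ<n p)

  rank≡toℕ⇒≈ : ∀ {p c} → rank p ≡ toℕ c → c ≈ p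
  rank≡toℕ⇒≈ {p} e with l , l≡rank , l≈p ← least-witness (_≈? p) (≈-refl {p}) =
    subst (_≈ p) (toℕ-injective (trans l≡rank e)) l≈p

  rank<rank⇔ : ∀ p q → (rank p < rank q) ⇔ (∃ λ l → l ≈ p × ∀ l′ → l′ ≈ q → toℕ l < toℕ l′)
  rank<rank⇔ p q = least<least⇔ (_≈? p) (_≈? q) ≈-refl ≈-refl

  rank-levelling : Levelling rank
  rank-levelling = record { origin-level = rank-zero ; ≈⇒≡ = rank-≈ }

  keepRanksBelow : ℕ → Point n → ℕ
  keepRanksBelow k = keepBelow k ∘ rank

  keepRanksBelow-levelling : ∀ k → Levelling (keepRanksBelow k)
  keepRanksBelow-levelling k = record
    { origin-level = trans (cong (keepBelow k) rank-zero) (keepBelow-0 k)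
    ; ≈⇒≡ = cong (keepBelow k) ∘ rank-≈
    }

  arrangement : (Point n → ℕ) → Fin n → ℕ
  arrangement = raise a (headroom a)

  arrangement-cong : ∀ {ρ ρ′} → (∀ p → ρ p ≡ ρ′ p) → ∀ k → arrangement ρ k ≡ arrangement ρ′ k
  arrangement-cong ρ≗ρ′ k = cong (λ l → a k + headroom a * l) (ρ≗ρ′ (suc k))

  canonical : Fin n → ℕ
  canonical = arrangement rank

  setLevel : (Point n → ℕ) → Point n → ℕ → Point n → ℕ
  setLevel ρ c w p = if does (p ≈? c) then w else ρ p

  setLevel-≈ : ∀ {ρ c w p} → p ≈ c → setLevel ρ c w p ≡ w
  setLevel-≈ {c = c} {p = p} p≈c = if-does (p ≈? c) (λ _ → refl) (λ p≉c → contradiction p≈c p≉c)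

  setLevel-≉ : ∀ {ρ c w p} → ¬ p ≈ c → setLevel ρ c w p ≡ ρ p
  setLevel-≉ {c = c} {p = p} p≉c = if-does (p ≈? c) (λ p≈c → contradiction p≈c p≉c) (λ _ → refl)

  setLevel-levelling : ∀ {ρ} → Levelling ρ → ∀ {c} → ¬ zero ≈ c → ∀ w → Levelling (setLevel ρ c w)
  setLevel-levelling {ρ} lev {c} 0≉c w = record { origin-level = trans (setLevel-≉ {ρ} 0≉c) origin-level ; ≈⇒≡ = ≈⇒≡′ }
    where
    open Levelling lev
    ≈⇒≡′ : ∀ {p q} → p ≈ q → setLevel ρ c w p ≡ setLevel ρ c w q
    ≈⇒≡′ {p} {q} p≈q = case p ≈? c of λ
      { (yes p≈c) → trans (setLevel-≈ {ρ} p≈c) (sym (setLevel-≈ {ρ} (≈-trans (≈-sym p≈q) p≈c)))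
      ; (no p≉c) → trans (setLevel-≉ {ρ} p≉c) (trans (≈⇒≡ p≈q) (sym (setLevel-≉ {ρ} (p≉c ∘ ≈-trans p≈q)))) }

  arrangement-rearrangement : ∀ {ρ} → Levelling ρ → Rearrangement (arrangement ρ)
  arrangement-rearrangement = Raise.raised-rearrangement a-rearrangement

  module Canonical (φ : QF n) (φ-offsets : OffsetsWithin R φ) (stable : (s : Fin n → Bool) → StableWrt δ φ s) where

    module _ {ρ : Point n → ℕ} (lev : Levelling ρ) {c : Point n} (0≉c : ¬ zero ≈ c) where

      setLevel-suc : ∀ w → ⟦ φ ⟧ δ (arrangement (setLevel ρ c w)) ⇔ ⟦ φ ⟧ δ (arrangement (setLevel ρ c (suc w)))
      setLevel-suc w = MoveCluster.move-cluster φ φ-offsets stable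
        (arrangement-rearrangement (setLevel-levelling lev 0≉c w)) (arrangement-rearrangement (setLevel-levelling lev 0≉c (suc w)))
        c 0≉c (headroom a) moved fixed
        where
        M : ℕ
        M = headroom a
        moved : ∀ k → suc k ≈ c → arrangement (setLevel ρ c (suc w)) k ≡ arrangement (setLevel ρ c w) k + M
        moved k k≈c = begin
          a k + M * setLevel ρ c (suc w) (suc k) ≡⟨ cong (λ l → a k + M * l) (setLevel-≈ {ρ} k≈c) ⟩
          a k + M * suc w                        ≡⟨ cong (a k +_) (trans (*-suc M w) (+-comm M _)) ⟩
          a k + (M * w + M)                      ≡⟨ +-assoc (a k) _ M ⟨
          a k + M * w + M                        ≡⟨ cong (λ l → a k + M * l + M) (setLevel-≈ {ρ} k≈c) ⟨
          a k + M * setLevel ρ c w (suc k) + M   ∎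
          where open ≡-Reasoning
        fixed : ∀ k → ¬ suc k ≈ c → arrangement (setLevel ρ c (suc w)) k ≡ arrangement (setLevel ρ c w) k
        fixed k k≉c = cong (λ l → a k + M * l) (trans (setLevel-≉ {ρ} k≉c) (sym (setLevel-≉ {ρ} k≉c)))

      setLevel-from-0 : ∀ w → ⟦ φ ⟧ δ (arrangement (setLevel ρ c 0)) ⇔ ⟦ φ ⟧ δ (arrangement (setLevel ρ c w))
      setLevel-from-0 zero = ⇔-refl
      setLevel-from-0 (suc w) = ⇔-trans (setLevel-from-0 w) (setLevel-suc w)

      relevel : ∀ {ρ′} → Levelling ρ′ → (∀ p → ¬ p ≈ c → ρ p ≡ ρ′ p) →
        ⟦ φ ⟧ δ (arrangement ρ) ⇔ ⟦ φ ⟧ δ (arrangement ρ′)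
      relevel {ρ′} lev′ ρ≗ρ′ =
        ⇔-trans (⟦⟧-cong φ (arrangement-cong ρ≗set))
          (⇔-trans (⇔-sym (setLevel-from-0 (ρ c)))
            (⇔-trans (setLevel-from-0 (ρ′ c)) (⟦⟧-cong φ (arrangement-cong set≗ρ′))))
        where
        ρ≗set : ∀ p → ρ p ≡ setLevel ρ c (ρ c) p
        ρ≗set p = case p ≈? c of λ
          { (yes p≈c) → trans (Levelling.≈⇒≡ lev p≈c) (sym (setLevel-≈ {ρ} p≈c))
          ; (no p≉c) → sym (setLevel-≉ {ρ} p≉c) }
        set≗ρ′ : ∀ p → setLevel ρ c (ρ′ c) p ≡ ρ′ p
        set≗ρ′ p = case p ≈? c of λ
          { (yes p≈c) → trans (setLevel-≈ {ρ} p≈c) (Levelling.≈⇒≡ lev′ (≈-sym p≈c))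
          ; (no p≉c) → trans (setLevel-≉ {ρ} p≉c) (ρ≗ρ′ p p≉c) }

    -- Only the cluster whose least point is c changes level, and it stays put if it is anchored at 0.
    rank-step : ∀ c → ⟦ φ ⟧ δ (arrangement (keepRanksBelow (toℕ c))) ⇔ ⟦ φ ⟧ δ (arrangement (keepRanksBelow (suc (toℕ c))))
    rank-step c with zero ≈? c
    ... | no 0≉c = relevel (keepRanksBelow-levelling (toℕ c)) 0≉c (keepRanksBelow-levelling (suc (toℕ c)))
                     λ p p≉c → keepBelow-suc (p≉c ∘ ≈-sym ∘ rank≡toℕ⇒≈ {p} {c})
    ... | yes 0≈c = ⟦⟧-cong φ (arrangement-cong same)
      where
      same : ∀ p → keepRanksBelow (toℕ c) p ≡ keepRanksBelow (suc (toℕ c)) p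
      same p with rank p ≟ toℕ c
      ... | no rank≢c = keepBelow-suc rank≢c
      ... | yes rank≡c rewrite trans (rank-≈ (≈-trans (≈-sym (rank≡toℕ⇒≈ rank≡c)) (≈-sym 0≈c))) rank-zero =
        trans (keepBelow-0 (toℕ c)) (sym (keepBelow-0 (suc (toℕ c))))

    ranks-below : ∀ k → k ≤ suc n → ⟦ φ ⟧ δ (arrangement (keepRanksBelow 0)) ⇔ ⟦ φ ⟧ δ (arrangement (keepRanksBelow k))
    ranks-below zero _ = ⇔-refl
    ranks-below (suc k) k<1+n = ⇔-trans (ranks-below k (<⇒≤ k<1+n))
      (subst (λ j → ⟦ φ ⟧ δ (arrangement (keepRanksBelow j)) ⇔ ⟦ φ ⟧ δ (arrangement (keepRanksBelow (suc j))))
        (toℕ-fromℕ< k<1+n) (rank-step (fromℕ< k<1+n)))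

    φ-canonical : ⟦ φ ⟧ δ a ⇔ ⟦ φ ⟧ δ canonical
    φ-canonical =
      ⇔-trans (⟦⟧-cong φ unraised)
        (⇔-trans (ranks-below (suc n) ≤-refl) (⟦⟧-cong φ (arrangement-cong λ p → keepBelow-< (rank<1+n p))))
      where
      unraised : ∀ k → a k ≡ arrangement (keepRanksBelow 0) k
      unraised k = sym (trans (cong (λ l → a k + headroom a * l) refl)
                              (trans (cong (a k +_) (*-zeroʳ (headroom a))) (+-identityʳ (a k))))

  canonical-rearrangement : Rearrangement canonical
  canonical-rearrangement = arrangement-rearrangement rank-levelling

  ⟦ltFormula⟧ : ∀ t u → offset t ≤ R → offset u ≤ R → ⟦ ltFormula R L t u ⟧ δ a ⇔ ⟦ t ≺ u ⟧ δ canonical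
  ⟦ltFormula⟧ t u t≤R u≤R with base t ≈? base u
  ... | yes p≈q =
    ⇔-trans (guarded-⇔ˡ (Equivalence.from (⟦closeFormula⟧ a L (base t) (base u)) p≈q))
      (⇔-trans (⟦shortLtFormula⟧ (L + R) t u a u≤t+L+R) (⇔-sym (near-≺⇔a canonical-rearrangement t u p≈q)))
    where
    open ≤-Reasoning
    u≤t+L+R : ⟦ u ⟧t a ≤ ⟦ t ⟧t a + (L + R)
    u≤t+L+R = begin
      ⟦ u ⟧t a                          ≡⟨ ⟦⟧t-normal u a ⟩
      value a (base u) + offset u       ≤⟨ +-monoʳ-≤ _ u≤R ⟩
      value a (base u) + R              ≤⟨ +-monoˡ-≤ R (<⇒≤ (Near.q<p+L p≈q)) ⟩
      value a (base t) + L + R          ≡⟨ +-assoc _ L R ⟩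
      value a (base t) + (L + R)        ≤⟨ +-monoˡ-≤ (L + R) (m≤m+n (value a (base t)) (offset t)) ⟩
      value a (base t) + offset t + (L + R) ≡⟨ cong (_+ (L + R)) (⟦⟧t-normal t a) ⟨
      ⟦ t ⟧t a + (L + R)                ∎
  ... | no p≉q =
    ⇔-trans (guarded-⇔ʳ (p≉q ∘ Equivalence.to (⟦closeFormula⟧ a L (base t) (base u))))
      (⇔-trans (⟦rankLtFormula⟧ a L (base t) (base u))
        (⇔-trans (⇔-sym (rank<rank⇔ (base t) (base u)))
          (⇔-trans ranks-distinct
            (⇔-trans (⇔-sym (Raise.raised-lex a-rearrangement rank-levelling p≉q))
              (⇔-trans (⇔-sym (apart-offset-< _ _ t≤R u≤R (Rearrangement.far-apart canonical-rearrangement p≉q)))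
                (⇔-sym (⟦≺⟧-normal {δ = δ} t u canonical)))))))
    where
    ranks-distinct : (rank (base t) < rank (base u)) ⇔ LexBelow rank a (base t) (base u)
    ranks-distinct = mk⇔ inj₁ λ { (inj₁ lt) → lt ; (inj₂ (e , _)) → contradiction (rank-≡⇒≈ e) p≉q }

  ⟦translate⟧ : ∀ χ → OffsetsWithin R χ → ⟦ translate R L χ ⟧ δ a ⇔ ⟦ χ ⟧ δ canonical
  ⟦translate⟧ ⊤f _ = ⇔-refl
  ⟦translate⟧ ⊥f _ = ⇔-refl
  ⟦translate⟧ (t ≐ u) (t≤R , u≤R) = agree-≐ a-rearrangement canonical-rearrangement t u t≤R u≤R
  ⟦translate⟧ (P t) _ = agree-P a-rearrangement canonical-rearrangement t
  ⟦translate⟧ (t ≺ u) (t≤R , u≤R) = ⟦ltFormula⟧ t u t≤R u≤R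
  ⟦translate⟧ (¬f χ) bχ = ¬-cong-⇔ (⟦translate⟧ χ bχ)
  ⟦translate⟧ (χ ∧f ψ) (bχ , bψ) = ⟦translate⟧ χ bχ ×-⇔ ⟦translate⟧ ψ bψ
  ⟦translate⟧ (χ ∨f ψ) (bχ , bψ) = ⟦translate⟧ χ bχ ⊎-⇔ ⟦translate⟧ ψ bψ

  φ⇔translate : ∀ φ → OffsetsWithin R φ → ((s : Fin n → Bool) → StableWrt δ φ s) →
    ⟦ φ ⟧ δ a ⇔ ⟦ translate R L φ ⟧ δ a
  φ⇔translate φ φ-offsets stable = ⇔-trans (Canonical.φ-canonical φ φ-offsets stable) (⇔-sym (⟦translate⟧ φ φ-offsets))

proposition3p3 : (δ : ℕ) → .{{_ : NonZero δ}} → (n : ℕ) → (φ : QF n) →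
    ((s : Fin n → Bool) → StableWrt δ φ s) →
    Σ (QF n) λ ψ → LtFree ψ × EquivInM δ φ ψ
proposition3p3 δ n φ stable =
  ψ , ⋁-LtFree disjunct (λ t → and (gapFormula-LtFree (L t)) (translate-LtFree R (L t) φ)) , φ⇔ψ
  where
  R : ℕ
  R = maxOffset φ
  L : Fin (suc (suc n * suc n)) → ℕ
  L t = scale R (toℕ t)
  disjunct : Fin (suc (suc n * suc n)) → QF n
  disjunct t = gapFormula (L t) ∧f translate R (L t) φ
  ψ : QF n
  ψ = ⋁ disjunct
  φ⇔translateAt : ∀ a t → Gap a (L t) → ⟦ φ ⟧ δ a ⇔ ⟦ translate R (L t) φ ⟧ δ a
  φ⇔translateAt a t gap = Clustered.φ⇔translate δ R (L t) (R<scale R (toℕ t)) a gap φ (offsetsWithin-maxOffset φ) stable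
  φ⇔ψ : EquivInM δ φ ψ
  φ⇔ψ a = mk⇔
    (λ φa → let t , gap = gap-exists a R in
      Equivalence.from (⟦⋁⟧ disjunct) (t , Equivalence.from (⟦gapFormula⟧ a (L t)) gap , Equivalence.to (φ⇔translateAt a t gap) φa))
    (λ ψa → let t , gapF , tr = Equivalence.to (⟦⋁⟧ disjunct) ψa in
      Equivalence.from (φ⇔translateAt a t (Equivalence.to (⟦gapFormula⟧ a (L t)) gapF)) tr)
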